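{- Let $n\ge1$ and $k\in\{0,1,\dots,2^n\}$. Then $c_{n,0}=2$, and if $k\ge1$, $$c_{n,2k}=\sum_{j=1}^{k}a_{j,k}\,2^{2jn},$$ where the rational numbers $a_{j,k}$ ($1\le j\le k$), which do not depend on $n$, are defined recursively as in the context.
   Context: The polynomials $p_n(x)\in\mathbb{Z}[x]$ are defined by $p_0(x)=x^2-2$ and $p_n(x)=p_{n-1}(x)^2-2$ for $n\ge1$; $c_{n,k}$ denotes the coefficient of $x^k$ in $p_n(x)$. Let $\epsilon(k)=1$ if $k$ is even and $0$ if $k$ is odd. For $k\ge1$ let $\eta_k=\lceil\log_2 k\rceil$, and for $j\ge2$ let $b_j=2^{ -2}(2^{2(j-1)}-1)^{ -1}$. Empty sums are $0$. The numbers $a_{j,k}$ ($1\le j\le k$) are defined by recursion on $k$, and for fixed $k\ge2$ first for $j=k,k-1,\dots,2$ and then for $j=1$: $a_{1,1}=-1$; for $k\ge2$ and $j\in\{2,\dots,k\}$: $a_{j,k}=b_j\,w_0(j,k)$; for $k\ge2$: $a_{1,k}=\sum_{l=2}^{k}\big(2^{ -2l}w_k(l,k)-a_{l,k}\big)\,2^{2\eta_k(l-1)}$. Here, for $L\in\{0,k\}$, $w_L(j,k)=\epsilon(k)\epsilon(j)\,a_{j/2,k/2}^2+u(j,k)+2v_L(j,k)$ (the first term being $0$ unless $j$ and $k$ are both even), where $u(j,k)=2\sum_{l=\max(1,\,j-k/2)}^{\min(\lfloor (j-1)/2\rfloor,\,k/2-1)}a_{l,k/2}\,a_{j-l,k/2}$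 if $k$ is even and $3\le j\le k-1$, and $u(j,k)=0$ otherwise; $v_L(j,k)=\sum_{s=\sigma_L}^{\lfloor (k-1)/2\rfloor}\ \sum_{r=\max(1,\,j-k+s)}^{\min(j-1,\,s)}a_{r,s}\,a_{j-r,k-s}$, with $\sigma_0=0$ and $\sigma_k=k-2^{\eta_k-1}$. -}

module Defs where

open import Data.Bool using (Bool; true; false; if_then_else_; _∧_)
open import Data.Nat as ℕ using (ℕ; zero; suc; _∸_; _≤_; NonZero; >-nonZero; z≤n; s≤s; _⊓_; _⊔_)
open import Data.Nat.Properties using (m^n>0; m^n≢0; m*n≢0; *-monoʳ-≤; ∸-monoˡ-≤; <-≤-trans)
open import Data.Nat.Logarithm using (⌈log₂_⌉)
open import Data.Integer as ℤ using (ℤ; +_)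
open import Data.Rational as ℚ using (ℚ; 0ℚ; _/_)
import Relation.Nullary
open import Data.List using (List; []; _∷_; map)

-- Polynomials over ℤ as coefficient lists (lowest degree first)

polyAdd : List ℤ → List ℤ → List ℤ
polyAdd []       q        = q
polyAdd p        []       = p
polyAdd (a ∷ p)  (b ∷ q)  = (a ℤ.+ b) ∷ polyAdd p q

polyMul : List ℤ → List ℤ → List ℤ
polyMul []      q = []
polyMul (a ∷ p) q = polyAdd (map (a ℤ.*_) q) (+ 0 ∷ polyMul p q)

coeff : List ℤ → ℕ → ℤ
coeff []      k       = + 0
coeff (a ∷ p) zero    = a
coeff (a ∷ p) (suc k) = coeff p k

p : ℕ → List ℤ
p zero    = ℤ.- (+ 2) ∷ + 0 ∷ + 1 ∷ []
p (suc n) = polyAdd (polyMul (p n) (p n)) (ℤ.- (+ 2) ∷ [])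

c : ℕ → ℕ → ℤ
c n k = coeff (p n) k

ℕtoℚ : ℕ → ℚ
ℕtoℚ m = (+ m) / 1

ℤtoℚ : ℤ → ℚ
ℤtoℚ z = z / 1

isEven : ℕ → Bool
isEven zero          = true
isEven (suc zero)    = false
isEven (suc (suc m)) = isEven m

leq : ℕ → ℕ → Bool
leq m n = m ℕ.≤ᵇ n

half : ℕ → ℕ
half zero          = zero
half (suc zero)    = zero
half (suc (suc m)) = suc (half m)

sumFrom : ℕ → ℕ → (ℕ → ℚ) → ℚ
sumFrom lo zero      f = 0ℚ
sumFrom lo (suc cnt) f = f lo ℚ.+ sumFrom (suc lo) cnt f

-- Σ_{l = lo}^{hi} f l  (empty sum = 0 if hi < lo)
sumRange : ℕ → ℕ → (ℕ → ℚ) → ℚ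
sumRange lo hi f = sumFrom lo (suc hi ∸ lo) f

η : ℕ → ℕ
η k = ⌈log₂ k ⌉

-- b_j = 2^{-2} (2^{2(j-1)} - 1)^{-1}   (only used for j ≥ 2)
4^suc-1-nonZero : ∀ i → NonZero (4 ℕ.^ suc i ∸ 1)
4^suc-1-nonZero i =
  >-nonZero (<-≤-trans (s≤s z≤n) (∸-monoˡ-≤ 1 (*-monoʳ-≤ 4 (m^n>0 4 i))))

b : ℕ → ℚ
b zero          = 0ℚ
b (suc zero)    = 0ℚ
b (suc (suc i)) =
  _/_ (+ 1) (4 ℕ.* (4 ℕ.^ suc i ∸ 1))
    {{m*n≢0 4 (4 ℕ.^ suc i ∸ 1) {{_}} {{4^suc-1-nonZero i}}}}

inv4^ : ℕ → ℚ
inv4^ l = _/_ (+ 1) (4 ℕ.^ l) {{m^n≢0 4 l}}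

-- The numbers a_{j,k}.  Given `prev` (intended: prev j k' = a_{j,k'} for
-- all k' < k), we compute the row k.

module Row (prev : ℕ → ℕ → ℚ) where

  sqTerm : ℕ → ℕ → ℚ
  sqTerm j k = if isEven j ∧ isEven k
               then prev (half j) (half k) ℚ.* prev (half j) (half k)
               else 0ℚ

  u : ℕ → ℕ → ℚ
  u j k = if isEven k ∧ leq 3 j ∧ leq j (k ∸ 1)
          then ℕtoℚ 2 ℚ.* sumRange (1 ⊔ (j ∸ half k)) (half (j ∸ 1) ⊓ (half k ∸ 1))
                                   (λ l → prev l (half k) ℚ.* prev (j ∸ l) (half k))
          else 0ℚ

  v : ℕ → ℕ → ℕ → ℚ
  v σ j k = sumRange σ (half (k ∸ 1)) (λ s →
              sumRange (1 ⊔ ((j ℕ.+ s) ∸ k)) ((j ∸ 1) ⊓ s) (λ r →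
                prev r s ℚ.* prev (j ∸ r) (k ∸ s)))

  w : ℕ → ℕ → ℕ → ℚ
  w σ j k = sqTerm j k ℚ.+ u j k ℚ.+ ℕtoℚ 2 ℚ.* v σ j k

  σ₀ : ℕ → ℕ
  σ₀ k = 0

  σₖ : ℕ → ℕ
  σₖ k = k ∸ 2 ℕ.^ (η k ∸ 1)

  aHigh : ℕ → ℕ → ℚ
  aHigh j k = b j ℚ.* w (σ₀ k) j k

  aOne : ℕ → ℚ
  aOne k = sumRange 2 k (λ l →
             (inv4^ l ℚ.* w (σₖ k) l k ℚ.- aHigh l k)
               ℚ.* ℕtoℚ (2 ℕ.^ (2 ℕ.* η k ℕ.* (l ∸ 1))))

  -- the row k (values outside 1 ≤ j ≤ k are set to 0 and never used)
  row : ℕ → ℕ → ℚ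
  row j zero = 0ℚ
  row zero (suc k) = 0ℚ
  row (suc zero) (suc zero) = ℚ.- (ℕtoℚ 1)
  row (suc (suc j)) (suc zero) = 0ℚ
  row j (suc (suc k)) =
    if leq j (suc (suc k))
    then (if leq 2 j then aHigh j (suc (suc k)) else aOne (suc (suc k)))
    else 0ℚ

-- table m j k = a_{j,k} for all k < m
table : ℕ → ℕ → ℕ → ℚ
table zero    j k = 0ℚ
table (suc m) j k with k ℕ.≟ m
... | Relation.Nullary.yes _ = Row.row (table m) j m
... | Relation.Nullary.no  _ = table m j k

a : ℕ → ℕ → ℚ
a j k = table (suc k) j k

-- Put Q_k(Y) = Σ_{j=1}^k a_{j,k} Y^j. Squaring p_n and using that its odd coefficients vanish and
-- c_{n,0} = 2 gives c_{n+1,2k} = 4 c_{n,2k} + Σ_{s=1}^{k-1} c_{n,2s} c_{n,2(k-s)}. On the other side,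
-- expanding the products Q_s Q_{k-s} and pairing s with k - s gives
-- Σ_{s=σ}^{k-σ} Q_s(Y) Q_{k-s}(Y) = Σ_l w_σ(l,k) Y^l, while b_l (4^l - 4) = 1 gives
-- Q_k(4Y) = 4 Q_k(Y) + Σ_l w_0(l,k) Y^l. So, by induction on k, the defect c_{n,2k} - Q_k(4^n) is
-- multiplied by 4 from one n to the next, and it suffices to find one n ≥ 1 where it vanishes. For
-- k ≤ 2 this is n = 1, by evaluation. For k ≥ 3 it is n = η_k: since 2^{η_k - 1} < k ≤ 2^{η_k},
-- c_{η_k - 1, 2k} = 0 and only the products with σ_k ≤ s ≤ k - σ_k survive, so
-- c_{η_k, 2k} = Σ_l w_{σ_k}(l,k) 4^{(η_k - 1) l}, and the formula for a_{1,k} is exactly what makes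
-- Q_k(4^{η_k}) equal to this.

module Submission where

open import Defs
open import Data.Nat using (ℕ; _≤_; _^_; _*_)
open import Data.Integer using (+_)
open import Data.Rational as ℚ using (ℚ)
open import Data.Product using (_×_)
open import Relation.Binary.PropositionalEquality using (_≡_)

open import Algebra.Bundles using (CommutativeRing)
open import Data.Bool using (Bool; true; false; if_then_else_; _∧_)
open import Data.Bool.Properties using (∧-zeroʳ; ∧-identityʳ)
open import Data.Empty using (⊥-elim)
open import Data.Integer as ℤ using (ℤ)
import Data.Integer.Properties as ℤP
open import Data.List using (List; []; _∷_; map)
open import Data.Nat as ℕ using (zero; suc; _+_; _∸_; _<_; z≤n; s≤s; z<s; s<s; _⊓_; _⊔_)
open import Data.Nat.Coprimality using (1-coprimeTo)
import Data.Nat.Coprimality as Coprime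
open import Data.Nat.Induction using (<-rec)
open import Data.Nat.Logarithm using (⌈log₂⌉-mono-≤; ⌈log₂⌈n/2⌉⌉≡⌈log₂n⌉∸1; ⌈log₂2^n⌉≡n)
open import Data.Nat.Properties
open import Data.Product using (_,_; ∃)
open import Data.Rational using (0ℚ; 1ℚ)
  renaming (_+_ to _+ℚ_; _*_ to _*ℚ_; _-_ to _-ℚ_)
import Data.Rational.Properties as ℚP
open import Data.Rational.Solver using (module +-*-Solver)
open import Algebra.Properties.Group ℚP.+-0-group using (x∙y⁻¹≈ε⇒x≈y)
import Data.Rational.Unnormalised as ℚᵘ
import Data.Rational.Unnormalised.Properties as ℚᵘP
open import Data.Sum using (_⊎_; inj₁; inj₂)
open import Relation.Binary.PropositionalEquality
  using (refl; sym; trans; cong; cong₂; subst; module ≡-Reasoning)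
open import Relation.Nullary using (yes; no; contradiction)
open import Relation.Nullary.Decidable using (dec-true; dec-false)

open import Algebra.Properties.CommutativeSemiring.Exp
  (CommutativeRing.commutativeSemiring ℚP.+-*-commutativeRing)
  using (^-distrib-*; ^-assocʳ) renaming (_^_ to _^ℚ_)
open +-*-Solver using (solve; _:+_; _:*_; _:-_; _:=_; con)

2ℚ 4ℚ : ℚ
2ℚ = ℕtoℚ 2
4ℚ = ℕtoℚ 4

x≡0⇒x*y≡0 : ∀ {x} y → x ≡ 0ℚ → x *ℚ y ≡ 0ℚ
x≡0⇒x*y≡0 y refl = ℚP.*-zeroˡ y

y≡0⇒x*y≡0 : ∀ x {y} → y ≡ 0ℚ → x *ℚ y ≡ 0ℚ
y≡0⇒x*y≡0 x refl = ℚP.*-zeroʳ x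

ℤtoℚ-mkℚ : ∀ z → ℤtoℚ z ≡ ℚ.mkℚ z 0 (Coprime.sym (1-coprimeTo ℤ.∣ z ∣))
ℤtoℚ-mkℚ z = ℚP.fromℚᵘ-toℚᵘ (ℚ.mkℚ z 0 (Coprime.sym (1-coprimeTo ℤ.∣ z ∣)))

ℤtoℚ-+ : ∀ x y → ℤtoℚ (x ℤ.+ y) ≡ ℤtoℚ x +ℚ ℤtoℚ y
ℤtoℚ-+ x y rewrite ℤtoℚ-mkℚ x | ℤtoℚ-mkℚ y | ℤP.*-identityʳ x | ℤP.*-identityʳ y = refl

ℤtoℚ-* : ∀ x y → ℤtoℚ (x ℤ.* y) ≡ ℤtoℚ x *ℚ ℤtoℚ y
ℤtoℚ-* x y rewrite ℤtoℚ-mkℚ x | ℤtoℚ-mkℚ y = refl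

ℕtoℚ-+ : ∀ m n → ℕtoℚ (m + n) ≡ ℕtoℚ m +ℚ ℕtoℚ n
ℕtoℚ-+ m n = trans (cong ℤtoℚ (ℤP.pos-+ m n)) (ℤtoℚ-+ (+ m) (+ n))

ℕtoℚ-* : ∀ m n → ℕtoℚ (m * n) ≡ ℕtoℚ m *ℚ ℕtoℚ n
ℕtoℚ-* m n = trans (cong ℤtoℚ (ℤP.pos-* m n)) (ℤtoℚ-* (+ m) (+ n))

ℕtoℚ-^ : ∀ m e → ℕtoℚ (m ^ e) ≡ ℕtoℚ m ^ℚ e
ℕtoℚ-^ m zero    = refl
ℕtoℚ-^ m (suc e) = trans (ℕtoℚ-* m (m ^ e)) (cong (ℕtoℚ m *ℚ_) (ℕtoℚ-^ m e))

ℕtoℚ-2^[2*m] : ∀ m → ℕtoℚ (2 ^ (2 * m)) ≡ 4ℚ ^ℚ m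
ℕtoℚ-2^[2*m] m = trans (cong ℕtoℚ (sym (^-*-assoc 2 2 m))) (ℕtoℚ-^ 4 m)

/-*-cancel : ∀ n .{{_ : ℕ.NonZero n}} i → (i ℚ./ n) *ℚ ℕtoℚ n ≡ ℤtoℚ i
/-*-cancel (suc d) i = trans (sym (ℚP.fromℚᵘ-toℚᵘ ((i ℚ./ suc d) *ℚ ℕtoℚ (suc d)))) (ℚP.fromℚᵘ-cong equiv)
  where
  equiv : ℚ.toℚᵘ ((i ℚ./ suc d) *ℚ ℕtoℚ (suc d)) ℚᵘ.≃ ℚᵘ.mkℚᵘ i 0
  equiv = ℚᵘP.≃-trans (ℚP.toℚᵘ-homo-* (i ℚ./ suc d) (ℕtoℚ (suc d)))
    (ℚᵘP.≃-trans (ℚᵘP.*-cong (ℚP.toℚᵘ-fromℚᵘ (ℚᵘ.mkℚᵘ i d)) (ℚP.toℚᵘ-fromℚᵘ (ℚᵘ.mkℚᵘ (+ suc d) 0)))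
      (ℚᵘ.*≡* (trans (ℤP.*-identityʳ (i ℤ.* + suc d)) (cong (λ x → i ℤ.* + suc x) (sym (*-identityʳ d))))))

ℕtoℚ[m]*x≡0⇒x≡0 : ∀ m .{{_ : ℕ.NonZero m}} x → ℕtoℚ m *ℚ x ≡ 0ℚ → x ≡ 0ℚ
ℕtoℚ[m]*x≡0⇒x≡0 m x mx≡0 = begin
  x                           ≡⟨ sym (ℚP.*-identityˡ x) ⟩
  1ℚ *ℚ x                     ≡⟨ cong (_*ℚ x) (sym (/-*-cancel m (+ 1))) ⟩
  (+ 1 ℚ./ m) *ℚ ℕtoℚ m *ℚ x  ≡⟨ ℚP.*-assoc (+ 1 ℚ./ m) (ℕtoℚ m) x ⟩
  (+ 1 ℚ./ m) *ℚ (ℕtoℚ m *ℚ x) ≡⟨ y≡0⇒x*y≡0 (+ 1 ℚ./ m) mx≡0 ⟩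
  0ℚ                          ∎
  where open ≡-Reasoning

half-≤ : ∀ k → half k ≤ k
half-≤ zero          = z≤n
half-≤ (suc zero)    = z≤n
half-≤ (suc (suc k)) = s≤s (m≤n⇒m≤1+n (half-≤ k))

half-< : ∀ k → 1 ≤ k → half k < k
half-< (suc zero)    _ = z<s
half-< (suc (suc k)) _ = s<s (s≤s (half-≤ k))

half+half≤ : ∀ n → half n + half n ≤ n
half+half≤ zero          = z≤n
half+half≤ (suc zero)    = z≤n
half+half≤ (suc (suc n)) = s≤s (subst (_≤ suc n) (sym (+-suc (half n) (half n))) (s≤s (half+half≤ n)))

half+half≡ : ∀ n → isEven n ≡ true → half n + half n ≡ n
half+half≡ zero          _  = refl
half+half≡ (suc (suc n)) ev = cong suc (trans (+-suc (half n) (half n)) (cong suc (half+half≡ n ev)))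

∸half≡half : ∀ n → isEven n ≡ true → n ∸ half n ≡ half n
∸half≡half n ev = trans (cong (_∸ half n) (sym (half+half≡ n ev))) (m+n∸m≡n (half n) (half n))

half-+-double : ∀ m e → half (m + (m + e)) ≡ m + half e
half-+-double zero    e = refl
half-+-double (suc m) e rewrite +-suc m (m + e) = cong suc (half-+-double m e)

isEven-+-double : ∀ m e → isEven (m + (m + e)) ≡ isEven e
isEven-+-double zero    e = refl
isEven-+-double (suc m) e rewrite +-suc m (m + e) = isEven-+-double m e

even⊎odd : ∀ r → (∃ λ q → r ≡ 2 * q) ⊎ (∃ λ q → r ≡ suc (2 * q))
even⊎odd zero    = inj₁ (0 , refl)
even⊎odd (suc r) with even⊎odd r
... | inj₁ (q , r≡2q)   = inj₂ (q , cong suc r≡2q)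
... | inj₂ (q , r≡2q+1) = inj₁ (suc q , trans (cong suc r≡2q+1) (sym (*-suc 2 q)))

<∸-swap : ∀ {i l h} → i < l ∸ h → h < l ∸ i
<∸-swap {i} {l} {h} i<l∸h =
  m+n≤o⇒m≤o∸n (suc h) (subst (_≤ l) (cong suc (+-comm i h)) (m≤o∸n⇒m+n≤o (suc i) h≤l i<l∸h))
  where
  h≤l : h ≤ l
  h≤l = <⇒≤ (m∸n≢0⇒n<m (λ l∸h≡0 → <⇒≱ i<l∸h (subst (_≤ i) (sym l∸h≡0) z≤n)))

m∸1<n⇒m≤n : ∀ {m n} → m ∸ 1 < n → m ≤ n
m∸1<n⇒m≤n {zero}  _   = z≤n
m∸1<n⇒m≤n {suc m} m<n = m<n

1+i<1⊔x⇒1+i<x : ∀ {i} x → suc i < 1 ⊔ x → suc i < x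
1+i<1⊔x⇒1+i<x zero    (s≤s ())
1+i<1⊔x⇒1+i<x (suc x) 1+i<x = 1+i<x

+-∸-comm-∸ : ∀ l {s k} → s ≤ k → (l + s) ∸ k ≡ l ∸ (k ∸ s)
+-∸-comm-∸ l {s} {k} s≤k = trans (cong₂ _∸_ (+-comm l s) (sym (m+[n∸m]≡n s≤k))) ([m+n]∸[m+o]≡n∸o s l (k ∸ s))

leq-true : ∀ {m n} → m ≤ n → leq m n ≡ true
leq-true {m} {n} = dec-true (m ≤? n)

leq-false : ∀ {m n} → n < m → leq m n ≡ false
leq-false {m} {n} n<m = dec-false (m ≤? n) (<⇒≱ n<m)

leq-false⁻ : ∀ {m n} → leq m n ≡ false → n < m
leq-false⁻ eq = ≰⇒> (λ m≤n → contradiction (trans (sym (leq-true m≤n)) eq) λ ())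

-- Finite sums

inRange⇒≤ : ∀ lo hi {i} → lo ≤ i → i < lo + (suc hi ∸ lo) → i ≤ hi
inRange⇒≤ lo hi {i} lo≤i i< with lo ≤? suc hi
... | yes lo≤1+hi = ≤-pred (subst (i <_) (m+[n∸m]≡n lo≤1+hi) i<)
... | no  lo≰1+hi = ⊥-elim (<-irrefl refl (<-≤-trans i<lo lo≤i))
  where
  i<lo : i < lo
  i<lo = subst (i <_) (trans (cong (_+_ lo) (m≤n⇒m∸n≡0 (<⇒≤ (≰⇒> lo≰1+hi)))) (+-identityʳ lo)) i<

sumFrom-cong : ∀ lo n {f g : ℕ → ℚ} → (∀ i → lo ≤ i → i < lo + n → f i ≡ g i) →
               sumFrom lo n f ≡ sumFrom lo n g
sumFrom-cong lo zero    f≗g = refl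
sumFrom-cong lo (suc n) f≗g =
  cong₂ _+ℚ_ (f≗g lo ≤-refl (m<m+n lo z<s))
    (sumFrom-cong (suc lo) n (λ i lo<i i< → f≗g i (<⇒≤ lo<i) (subst (i <_) (sym (+-suc lo n)) i<)))

sumRange-cong : ∀ lo hi {f g : ℕ → ℚ} → (∀ i → lo ≤ i → i ≤ hi → f i ≡ g i) →
                sumRange lo hi f ≡ sumRange lo hi g
sumRange-cong lo hi f≗g = sumFrom-cong lo (suc hi ∸ lo) (λ i lo≤i i< → f≗g i lo≤i (inRange⇒≤ lo hi lo≤i i<))

sumFrom-zeros : ∀ lo n → sumFrom lo n (λ _ → 0ℚ) ≡ 0ℚ
sumFrom-zeros lo zero    = refl
sumFrom-zeros lo (suc n) = trans (cong (0ℚ +ℚ_) (sumFrom-zeros (suc lo) n)) (ℚP.+-identityˡ 0ℚ)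

sumFrom-≡0 : ∀ lo n (f : ℕ → ℚ) → (∀ i → lo ≤ i → i < lo + n → f i ≡ 0ℚ) → sumFrom lo n f ≡ 0ℚ
sumFrom-≡0 lo n f f≗0 = trans (sumFrom-cong lo n f≗0) (sumFrom-zeros lo n)

sumRange-≡0 : ∀ lo hi (f : ℕ → ℚ) → (∀ i → lo ≤ i → i ≤ hi → f i ≡ 0ℚ) → sumRange lo hi f ≡ 0ℚ
sumRange-≡0 lo hi f f≗0 = trans (sumRange-cong lo hi f≗0) (sumFrom-zeros lo (suc hi ∸ lo))

sumRange-empty : ∀ lo hi (f : ℕ → ℚ) → hi < lo → sumRange lo hi f ≡ 0ℚ
sumRange-empty lo hi f hi<lo = cong (λ n → sumFrom lo n f) (m≤n⇒m∸n≡0 hi<lo)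

sumFrom-split : ∀ lo m n (f : ℕ → ℚ) → sumFrom lo (m + n) f ≡ sumFrom lo m f +ℚ sumFrom (lo + m) n f
sumFrom-split lo zero    n f = trans (cong (λ x → sumFrom x n f) (sym (+-identityʳ lo))) (sym (ℚP.+-identityˡ _))
sumFrom-split lo (suc m) n f = begin
  f lo +ℚ sumFrom (suc lo) (m + n) f                               ≡⟨ cong (f lo +ℚ_) (sumFrom-split (suc lo) m n f) ⟩
  f lo +ℚ (sumFrom (suc lo) m f +ℚ sumFrom (suc lo + m) n f)       ≡⟨ sym (ℚP.+-assoc (f lo) _ _) ⟩
  f lo +ℚ sumFrom (suc lo) m f +ℚ sumFrom (suc lo + m) n f
    ≡⟨ cong (λ x → f lo +ℚ sumFrom (suc lo) m f +ℚ sumFrom x n f) (sym (+-suc lo m)) ⟩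
  f lo +ℚ sumFrom (suc lo) m f +ℚ sumFrom (lo + suc m) n f         ∎
  where open ≡-Reasoning

sumFrom-last : ∀ lo n (f : ℕ → ℚ) → sumFrom lo (suc n) f ≡ sumFrom lo n f +ℚ f (lo + n)
sumFrom-last lo n f = trans (cong (λ x → sumFrom lo x f) (+-comm 1 n))
  (trans (sumFrom-split lo n 1 f) (cong (sumFrom lo n f +ℚ_) (ℚP.+-identityʳ _)))

sumFrom-shift : ∀ lo n (f : ℕ → ℚ) → sumFrom (suc lo) n f ≡ sumFrom lo n (λ i → f (suc i))
sumFrom-shift lo zero    f = refl
sumFrom-shift lo (suc n) f = cong (f (suc lo) +ℚ_) (sumFrom-shift (suc lo) n f)

sumFrom-+ : ∀ lo n (f g : ℕ → ℚ) → sumFrom lo n (λ i → f i +ℚ g i) ≡ sumFrom lo n f +ℚ sumFrom lo n g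
sumFrom-+ lo zero    f g = refl
sumFrom-+ lo (suc n) f g = trans (cong (f lo +ℚ g lo +ℚ_) (sumFrom-+ (suc lo) n f g))
  (solve 4 (λ a b c d → a :+ b :+ (c :+ d) := a :+ c :+ (b :+ d)) refl (f lo) (g lo) _ _)

sumFrom-*ˡ : ∀ lo n x (f : ℕ → ℚ) → sumFrom lo n (λ i → x *ℚ f i) ≡ x *ℚ sumFrom lo n f
sumFrom-*ˡ lo zero    x f = sym (ℚP.*-zeroʳ x)
sumFrom-*ˡ lo (suc n) x f = trans (cong (x *ℚ f lo +ℚ_) (sumFrom-*ˡ (suc lo) n x f))
  (sym (ℚP.*-distribˡ-+ x _ _))

sumFrom-*ʳ : ∀ lo n x (f : ℕ → ℚ) → sumFrom lo n (λ i → f i *ℚ x) ≡ sumFrom lo n f *ℚ x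
sumFrom-*ʳ lo n x f = trans (sumFrom-cong lo n (λ i _ _ → ℚP.*-comm (f i) x))
  (trans (sumFrom-*ˡ lo n x f) (ℚP.*-comm x _))

sumFrom-swap : ∀ a m b n (g : ℕ → ℕ → ℚ) →
  sumFrom a m (λ i → sumFrom b n (g i)) ≡ sumFrom b n (λ j → sumFrom a m (λ i → g i j))
sumFrom-swap a zero    b n g = sym (sumFrom-zeros b n)
sumFrom-swap a (suc m) b n g = trans (cong (sumFrom b n (g a) +ℚ_) (sumFrom-swap (suc a) m b n g))
  (sym (sumFrom-+ b n (g a) (λ j → sumFrom (suc a) m (λ i → g i j))))

sumFrom-reverse : ∀ l (f : ℕ → ℚ) → sumFrom 0 (suc l) f ≡ sumFrom 0 (suc l) (λ r → f (l ∸ r))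
sumFrom-reverse zero    f = refl
sumFrom-reverse (suc l) f = begin
  f 0 +ℚ sumFrom 1 (suc l) f
    ≡⟨ cong (f 0 +ℚ_) (trans (sumFrom-shift 0 (suc l) f) (sumFrom-reverse l (λ i → f (suc i)))) ⟩
  f 0 +ℚ sumFrom 0 (suc l) (λ r → f (suc (l ∸ r)))
    ≡⟨ cong (f 0 +ℚ_) (sumFrom-cong 0 (suc l) (λ r _ r< → cong f (sym (+-∸-assoc 1 (≤-pred r<))))) ⟩
  f 0 +ℚ sumFrom 0 (suc l) f′
    ≡⟨ ℚP.+-comm (f 0) _ ⟩
  sumFrom 0 (suc l) f′ +ℚ f 0
    ≡⟨ cong (λ x → sumFrom 0 (suc l) f′ +ℚ f x) (sym (n∸n≡0 (suc l))) ⟩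
  sumFrom 0 (suc l) f′ +ℚ f′ (suc l)
    ≡⟨ sym (sumFrom-last 0 (suc l) f′) ⟩
  sumFrom 0 (suc (suc l)) f′ ∎
  where
  open ≡-Reasoning
  f′ : ℕ → ℚ
  f′ = λ r → f (suc l ∸ r)

sumRange-restrict : ∀ A B lo hi (f : ℕ → ℚ) → A ≤ lo → hi ≤ B →
  (∀ i → A ≤ i → i ≤ B → i < lo ⊎ hi < i → f i ≡ 0ℚ) → sumRange A B f ≡ sumRange lo hi f
sumRange-restrict A B lo hi f A≤lo hi≤B outside with lo ≤? hi
... | no lo≰hi = trans (sumRange-≡0 A B f (λ i A≤i i≤B → outside i A≤i i≤B (side i)))
                       (sym (sumRange-empty lo hi f (≰⇒> lo≰hi)))
  where
  side : ∀ i → i < lo ⊎ hi < i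
  side i with i <? lo
  ... | yes i<lo = inj₁ i<lo
  ... | no  i≮lo = inj₂ (<-≤-trans (≰⇒> lo≰hi) (≮⇒≥ i≮lo))
... | yes lo≤hi = begin
  sumFrom A (suc B ∸ A) f
    ≡⟨ cong (λ n → sumFrom A n f) lengths ⟩
  sumFrom A ((lo ∸ A) + ((suc hi ∸ lo) + (B ∸ hi))) f
    ≡⟨ sumFrom-split A (lo ∸ A) _ f ⟩
  sumFrom A (lo ∸ A) f +ℚ sumFrom (A + (lo ∸ A)) ((suc hi ∸ lo) + (B ∸ hi)) f
    ≡⟨ cong₂ _+ℚ_ below (cong (λ x → sumFrom x ((suc hi ∸ lo) + (B ∸ hi)) f) (m+[n∸m]≡n A≤lo)) ⟩
  0ℚ +ℚ sumFrom lo ((suc hi ∸ lo) + (B ∸ hi)) f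
    ≡⟨ trans (ℚP.+-identityˡ _) (sumFrom-split lo (suc hi ∸ lo) _ f) ⟩
  sumRange lo hi f +ℚ sumFrom (lo + (suc hi ∸ lo)) (B ∸ hi) f
    ≡⟨ cong (λ x → sumRange lo hi f +ℚ sumFrom x (B ∸ hi) f) (m+[n∸m]≡n (m≤n⇒m≤1+n lo≤hi)) ⟩
  sumRange lo hi f +ℚ sumFrom (suc hi) (B ∸ hi) f
    ≡⟨ trans (cong (sumRange lo hi f +ℚ_) above) (ℚP.+-identityʳ _) ⟩
  sumRange lo hi f ∎
  where
  open ≡-Reasoning
  lengths : suc B ∸ A ≡ (lo ∸ A) + ((suc hi ∸ lo) + (B ∸ hi))
  lengths = sym (begin
    (lo ∸ A) + ((suc hi ∸ lo) + (B ∸ hi)) ≡⟨ sym (+-assoc (lo ∸ A) _ _) ⟩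
    (lo ∸ A) + (suc hi ∸ lo) + (B ∸ hi)   ≡⟨ cong (_+ (B ∸ hi)) (trans (+-comm (lo ∸ A) _)
                                               (trans (sym (+-∸-assoc (suc hi ∸ lo) A≤lo))
                                                 (cong (_∸ A) (m∸n+n≡m (m≤n⇒m≤1+n lo≤hi))))) ⟩
    (suc hi ∸ A) + (B ∸ hi)               ≡⟨ sym (+-∸-comm (B ∸ hi) (≤-trans A≤lo (m≤n⇒m≤1+n lo≤hi))) ⟩
    (suc hi + (B ∸ hi)) ∸ A               ≡⟨ cong (λ x → suc x ∸ A) (m+[n∸m]≡n hi≤B) ⟩
    suc B ∸ A                             ∎)
  below : sumFrom A (lo ∸ A) f ≡ 0ℚ
  below = sumFrom-≡0 A (lo ∸ A) f (λ i A≤i i< →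
    let i<lo = subst (i <_) (m+[n∸m]≡n A≤lo) i<
    in outside i A≤i (≤-trans (<⇒≤ i<lo) (≤-trans lo≤hi hi≤B)) (inj₁ i<lo))
  above : sumFrom (suc hi) (B ∸ hi) f ≡ 0ℚ
  above = sumFrom-≡0 (suc hi) (B ∸ hi) f (λ i hi<i i< →
    outside i (≤-trans A≤lo (≤-trans lo≤hi (<⇒≤ hi<i)))
      (≤-pred (subst (i <_) (cong suc (m+[n∸m]≡n hi≤B)) i<)) (inj₂ hi<i))

sumFrom-pairs : ∀ d lo (f : ℕ → ℚ) → (∀ i → i ≤ d → f (lo + i) ≡ f (lo + (d ∸ i))) →
  sumFrom lo (suc d) f ≡ 2ℚ *ℚ sumFrom lo (half (suc d)) f +ℚ (if isEven d then f (lo + half d) else 0ℚ)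
sumFrom-pairs zero lo f _ = trans (ℚP.+-identityʳ (f lo))
  (trans (cong f (sym (+-identityʳ lo))) (sym (trans (cong (_+ℚ f (lo + 0)) (ℚP.*-zeroʳ 2ℚ)) (ℚP.+-identityˡ _))))
sumFrom-pairs (suc zero) lo f sym-f = begin
  f lo +ℚ (f (suc lo) +ℚ 0ℚ) ≡⟨ cong (λ x → f lo +ℚ (x +ℚ 0ℚ)) (trans (cong f (+-comm 1 lo))
                                  (trans (sym-f 1 ≤-refl) (cong f (+-identityʳ lo)))) ⟩
  f lo +ℚ (f lo +ℚ 0ℚ)       ≡⟨ solve 1 (λ x → x :+ (x :+ con 0ℚ) := con 2ℚ :* (x :+ con 0ℚ) :+ con 0ℚ) refl (f lo) ⟩
  2ℚ *ℚ (f lo +ℚ 0ℚ) +ℚ 0ℚ   ∎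
  where open ≡-Reasoning
sumFrom-pairs (suc (suc d)) lo f sym-f = begin
  f lo +ℚ sumFrom (suc lo) (suc (suc d)) f
    ≡⟨ cong (f lo +ℚ_) (sumFrom-last (suc lo) (suc d) f) ⟩
  f lo +ℚ (sumFrom (suc lo) (suc d) f +ℚ f (suc lo + suc d))
    ≡⟨ cong (λ x → f lo +ℚ (x +ℚ f (suc lo + suc d))) (sumFrom-pairs d (suc lo) f inner-sym) ⟩
  f lo +ℚ (2ℚ *ℚ S +ℚ middle (suc lo + half d) +ℚ f (suc lo + suc d))
    ≡⟨ cong₂ (λ x y → f lo +ℚ (2ℚ *ℚ S +ℚ middle x +ℚ y)) (sym (+-suc lo (half d))) last≡first ⟩
  f lo +ℚ (2ℚ *ℚ S +ℚ middle (lo + suc (half d)) +ℚ f lo)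
    ≡⟨ solve 3 (λ a s e → a :+ (con 2ℚ :* s :+ e :+ a) := con 2ℚ :* (a :+ s) :+ e) refl (f lo) S _ ⟩
  2ℚ *ℚ (f lo +ℚ S) +ℚ middle (lo + suc (half d)) ∎
  where
  open ≡-Reasoning
  S : ℚ
  S = sumFrom (suc lo) (half (suc d)) f
  middle : ℕ → ℚ
  middle i = if isEven d then f i else 0ℚ
  last≡first : f (suc lo + suc d) ≡ f lo
  last≡first = sym (trans (cong f (sym (+-identityʳ lo))) (trans (sym-f 0 z≤n) (cong f (+-suc lo (suc d)))))
  inner-sym : ∀ i → i ≤ d → f (suc lo + i) ≡ f (suc lo + (d ∸ i))
  inner-sym i i≤d = begin
    f (suc lo + i)         ≡⟨ cong f (sym (+-suc lo i)) ⟩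
    f (lo + suc i)         ≡⟨ sym-f (suc i) (s≤s (m≤n⇒m≤1+n i≤d)) ⟩
    f (lo + (suc d ∸ i))   ≡⟨ cong (λ x → f (lo + x)) (+-∸-assoc 1 i≤d) ⟩
    f (lo + suc (d ∸ i))   ≡⟨ cong f (+-suc lo (d ∸ i)) ⟩
    f (suc lo + (d ∸ i))   ∎

sumFrom-evenOdd : ∀ k (f : ℕ → ℚ) →
  sumFrom 0 (suc (2 * k)) f ≡ sumFrom 0 (suc k) (λ s → f (2 * s)) +ℚ sumFrom 0 k (λ s → f (suc (2 * s)))
sumFrom-evenOdd zero    f = sym (ℚP.+-identityʳ _)
sumFrom-evenOdd (suc k) f = begin
  sumFrom 0 (suc (2 * suc k)) f
    ≡⟨ cong (λ x → sumFrom 0 (suc x) f) (*-suc 2 k) ⟩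
  sumFrom 0 (suc (suc (suc (2 * k)))) f
    ≡⟨ trans (sumFrom-last 0 (suc (suc (2 * k))) f) (cong (_+ℚ f (2 + 2 * k)) (sumFrom-last 0 (suc (2 * k)) f)) ⟩
  sumFrom 0 (suc (2 * k)) f +ℚ f (suc (2 * k)) +ℚ f (2 + 2 * k)
    ≡⟨ cong (λ x → x +ℚ f (suc (2 * k)) +ℚ f (2 + 2 * k)) (sumFrom-evenOdd k f) ⟩
  E +ℚ O +ℚ f (suc (2 * k)) +ℚ f (2 + 2 * k)
    ≡⟨ solve 4 (λ a b x y → a :+ b :+ x :+ y := a :+ y :+ (b :+ x)) refl E O _ _ ⟩
  E +ℚ f (2 + 2 * k) +ℚ (O +ℚ f (suc (2 * k)))
    ≡⟨ cong (λ x → E +ℚ f x +ℚ (O +ℚ f (suc (2 * k)))) (sym (*-suc 2 k)) ⟩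
  E +ℚ f (2 * suc k) +ℚ (O +ℚ f (suc (2 * k)))
    ≡⟨ sym (cong₂ _+ℚ_ (sumFrom-last 0 (suc k) (λ s → f (2 * s))) (sumFrom-last 0 k (λ s → f (suc (2 * s))))) ⟩
  sumFrom 0 (suc (suc k)) (λ s → f (2 * s)) +ℚ sumFrom 0 (suc k) (λ s → f (suc (2 * s))) ∎
  where
  open ≡-Reasoning
  E : ℚ
  E = sumFrom 0 (suc k) (λ s → f (2 * s))
  O : ℚ
  O = sumFrom 0 k (λ s → f (suc (2 * s)))

-- Polynomials as coefficient sequences

eval : (ℕ → ℚ) → ℕ → ℚ → ℚ
eval F d Y = sumFrom 0 (suc d) (λ i → F i *ℚ Y ^ℚ i)

conv : (ℕ → ℚ) → (ℕ → ℚ) → ℕ → ℚ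
conv F G l = sumFrom 0 (suc l) (λ r → F r *ℚ G (l ∸ r))

eval-cong : ∀ F G d Y → (∀ i → F i ≡ G i) → eval F d Y ≡ eval G d Y
eval-cong F G d Y F≗G = sumFrom-cong 0 (suc d) (λ i _ _ → cong (_*ℚ Y ^ℚ i) (F≗G i))

eval-suc : ∀ F d Y → eval F (suc d) Y ≡ F 0 +ℚ Y *ℚ eval (λ i → F (suc i)) d Y
eval-suc F d Y = cong₂ _+ℚ_ (ℚP.*-identityʳ (F 0)) (begin
  sumFrom 1 (suc d) (λ i → F i *ℚ Y ^ℚ i)
    ≡⟨ sumFrom-shift 0 (suc d) (λ i → F i *ℚ Y ^ℚ i) ⟩
  sumFrom 0 (suc d) (λ i → F (suc i) *ℚ (Y *ℚ Y ^ℚ i))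
    ≡⟨ sumFrom-cong 0 (suc d) (λ i _ _ → solve 3 (λ a y p → a :* (y :* p) := y :* (a :* p)) refl (F (suc i)) Y (Y ^ℚ i)) ⟩
  sumFrom 0 (suc d) (λ i → Y *ℚ (F (suc i) *ℚ Y ^ℚ i))
    ≡⟨ sumFrom-*ˡ 0 (suc d) Y _ ⟩
  Y *ℚ eval (λ i → F (suc i)) d Y ∎)
  where open ≡-Reasoning

eval-+ : ∀ F G d Y → eval (λ i → F i +ℚ G i) d Y ≡ eval F d Y +ℚ eval G d Y
eval-+ F G d Y = trans (sumFrom-cong 0 (suc d) (λ i _ _ → ℚP.*-distribʳ-+ (Y ^ℚ i) (F i) (G i)))
  (sumFrom-+ 0 (suc d) (λ i → F i *ℚ Y ^ℚ i) (λ i → G i *ℚ Y ^ℚ i))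

eval-*ˡ : ∀ x F d Y → eval (λ i → x *ℚ F i) d Y ≡ x *ℚ eval F d Y
eval-*ˡ x F d Y = trans (sumFrom-cong 0 (suc d) (λ i _ _ → ℚP.*-assoc x (F i) (Y ^ℚ i)))
  (sumFrom-*ˡ 0 (suc d) x (λ i → F i *ℚ Y ^ℚ i))

eval-truncate : ∀ G T m Y → (∀ i → T < i → G i ≡ 0ℚ) → eval G (T + m) Y ≡ eval G T Y
eval-truncate G T m Y G-deg = trans (sumFrom-split 0 (suc T) m (λ i → G i *ℚ Y ^ℚ i))
  (trans (cong (eval G T Y +ℚ_) (sumFrom-≡0 (suc T) m (λ i → G i *ℚ Y ^ℚ i) (λ i T<i _ →
            x≡0⇒x*y≡0 (Y ^ℚ i) (G-deg i T<i))))
    (ℚP.+-identityʳ _))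

eval-from-1 : ∀ F d Y → F 0 ≡ 0ℚ → eval F d Y ≡ sumRange 1 d (λ i → F i *ℚ Y ^ℚ i)
eval-from-1 F d Y F0≡0 = trans (cong (_+ℚ sumRange 1 d (λ i → F i *ℚ Y ^ℚ i)) (x≡0⇒x*y≡0 1ℚ F0≡0))
  (ℚP.+-identityˡ _)

sumFrom-eval : ∀ lo n (F : ℕ → ℕ → ℚ) d Y →
  sumFrom lo n (λ s → eval (F s) d Y) ≡ eval (λ i → sumFrom lo n (λ s → F s i)) d Y
sumFrom-eval lo n F d Y = trans (sumFrom-swap lo n 0 (suc d) (λ s i → F s i *ℚ Y ^ℚ i))
  (sumFrom-cong 0 (suc d) (λ i _ _ → sumFrom-*ʳ lo n (Y ^ℚ i) (λ s → F s i)))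

conv-suc : ∀ F G l → conv F G (suc l) ≡ F 0 *ℚ G (suc l) +ℚ conv (λ i → F (suc i)) G l
conv-suc F G l = cong (F 0 *ℚ G (suc l) +ℚ_) (sumFrom-shift 0 (suc l) (λ r → F r *ℚ G (suc l ∸ r)))

conv-comm : ∀ F G l → conv F G l ≡ conv G F l
conv-comm F G l = trans (sumFrom-reverse l (λ r → F r *ℚ G (l ∸ r)))
  (sumFrom-cong 0 (suc l) (λ r _ r< → trans (cong (λ x → F (l ∸ r) *ℚ G x) (m∸[m∸n]≡n (≤-pred r<)))
    (ℚP.*-comm (F (l ∸ r)) (G r))))

conv-constˡ : ∀ F G l → (∀ i → 0 < i → F i ≡ 0ℚ) → conv F G l ≡ F 0 *ℚ G l
conv-constˡ F G zero    _    = ℚP.+-identityʳ _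
conv-constˡ F G (suc l) F-deg = trans (conv-suc F G l)
  (trans (cong (F 0 *ℚ G (suc l) +ℚ_) (sumFrom-≡0 0 (suc l) (λ r → F (suc r) *ℚ G (l ∸ r)) (λ r _ _ →
            x≡0⇒x*y≡0 (G (l ∸ r)) (F-deg (suc r) z<s))))
    (ℚP.+-identityʳ _))

conv-self : ∀ F l → conv F F l ≡
  2ℚ *ℚ sumFrom 0 (half (suc l)) (λ r → F r *ℚ F (l ∸ r)) +ℚ (if isEven l then F (half l) *ℚ F (half l) else 0ℚ)
conv-self F l = trans (sumFrom-pairs l 0 f f-sym) (cong (2ℚ *ℚ sumFrom 0 (half (suc l)) f +ℚ_) middle)
  where
  f : ℕ → ℚ
  f r = F r *ℚ F (l ∸ r)
  f-sym : ∀ i → i ≤ l → f i ≡ f (l ∸ i)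
  f-sym i i≤l = trans (ℚP.*-comm (F i) (F (l ∸ i))) (cong (λ j → F (l ∸ i) *ℚ F j) (sym (m∸[m∸n]≡n i≤l)))
  middle : (if isEven l then f (half l) else 0ℚ) ≡ (if isEven l then F (half l) *ℚ F (half l) else 0ℚ)
  middle with isEven l in ev
  ... | true  = cong (λ j → F (half l) *ℚ F j) (∸half≡half l ev)
  ... | false = refl

eval-conv-suc : ∀ F G N Y →
  eval (conv F G) (suc N) Y ≡ F 0 *ℚ eval G (suc N) Y +ℚ Y *ℚ eval (conv (λ i → F (suc i)) G) N Y
eval-conv-suc F G N Y = begin
  eval (conv F G) (suc N) Y
    ≡⟨ eval-suc (conv F G) N Y ⟩
  conv F G 0 +ℚ Y *ℚ eval (λ l → conv F G (suc l)) N Y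
    ≡⟨ cong₂ (λ x y → x +ℚ Y *ℚ y) (ℚP.+-identityʳ (F 0 *ℚ G 0))
         (eval-cong (λ l → conv F G (suc l)) (λ l → F 0 *ℚ G (suc l) +ℚ conv F′ G l) N Y (conv-suc F G)) ⟩
  F 0 *ℚ G 0 +ℚ Y *ℚ eval (λ l → F 0 *ℚ G (suc l) +ℚ conv F′ G l) N Y
    ≡⟨ cong (λ x → F 0 *ℚ G 0 +ℚ Y *ℚ x) (trans (eval-+ (λ l → F 0 *ℚ G (suc l)) (conv F′ G) N Y)
         (cong (_+ℚ eval (conv F′ G) N Y) (eval-*ˡ (F 0) G′ N Y))) ⟩
  F 0 *ℚ G 0 +ℚ Y *ℚ (F 0 *ℚ eval G′ N Y +ℚ eval (conv F′ G) N Y)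
    ≡⟨ solve 5 (λ f g y e c → f :* g :+ y :* (f :* e :+ c) := f :* (g :+ y :* e) :+ y :* c)
         refl (F 0) (G 0) Y (eval G′ N Y) (eval (conv F′ G) N Y) ⟩
  F 0 *ℚ (G 0 +ℚ Y *ℚ eval G′ N Y) +ℚ Y *ℚ eval (conv F′ G) N Y
    ≡⟨ cong (λ x → F 0 *ℚ x +ℚ Y *ℚ eval (conv F′ G) N Y) (sym (eval-suc G N Y)) ⟩
  F 0 *ℚ eval G (suc N) Y +ℚ Y *ℚ eval (conv F′ G) N Y ∎
  where
  open ≡-Reasoning
  F′ G′ : ℕ → ℚ
  F′ i = F (suc i)
  G′ i = G (suc i)

eval-* : ∀ F G S T Y → (∀ i → S < i → F i ≡ 0ℚ) → (∀ i → T < i → G i ≡ 0ℚ) →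
  eval F S Y *ℚ eval G T Y ≡ eval (conv F G) (S + T) Y
eval-* F G zero T Y F-deg G-deg = begin
  (F 0 *ℚ 1ℚ +ℚ 0ℚ) *ℚ eval G T Y ≡⟨ cong (_*ℚ eval G T Y) (trans (ℚP.+-identityʳ (F 0 *ℚ 1ℚ)) (ℚP.*-identityʳ (F 0))) ⟩
  F 0 *ℚ eval G T Y               ≡⟨ sym (eval-*ˡ (F 0) G T Y) ⟩
  eval (λ l → F 0 *ℚ G l) T Y     ≡⟨ eval-cong (λ l → F 0 *ℚ G l) (conv F G) T Y (λ l → sym (conv-constˡ F G l F-deg)) ⟩
  eval (conv F G) T Y             ∎
  where open ≡-Reasoning
eval-* F G (suc S) T Y F-deg G-deg = begin
  eval F (suc S) Y *ℚ eval G T Y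
    ≡⟨ cong (_*ℚ eval G T Y) (eval-suc F S Y) ⟩
  (F 0 +ℚ Y *ℚ eval F′ S Y) *ℚ eval G T Y
    ≡⟨ solve 4 (λ f y e g → (f :+ y :* e) :* g := f :* g :+ y :* (e :* g)) refl (F 0) Y (eval F′ S Y) (eval G T Y) ⟩
  F 0 *ℚ eval G T Y +ℚ Y *ℚ (eval F′ S Y *ℚ eval G T Y)
    ≡⟨ cong₂ (λ x y → F 0 *ℚ x +ℚ Y *ℚ y)
         (sym (trans (cong (λ d → eval G d Y) (+-comm (suc S) T)) (eval-truncate G T (suc S) Y G-deg)))
         (eval-* F′ G S T Y (λ i S<i → F-deg (suc i) (s<s S<i)) G-deg) ⟩
  F 0 *ℚ eval G (suc (S + T)) Y +ℚ Y *ℚ eval (conv F′ G) (S + T) Y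
    ≡⟨ sym (eval-conv-suc F G (S + T) Y) ⟩
  eval (conv F G) (suc (S + T)) Y ∎
  where
  open ≡-Reasoning
  F′ : ℕ → ℚ
  F′ i = F (suc i)

-- The coefficients of p n

coeff-polyAdd : ∀ P Q i → coeff (polyAdd P Q) i ≡ coeff P i ℤ.+ coeff Q i
coeff-polyAdd []      Q       i       = sym (ℤP.+-identityˡ (coeff Q i))
coeff-polyAdd (a ∷ P) []      i       = sym (ℤP.+-identityʳ (coeff (a ∷ P) i))
coeff-polyAdd (a ∷ P) (b ∷ Q) zero    = refl
coeff-polyAdd (a ∷ P) (b ∷ Q) (suc i) = coeff-polyAdd P Q i

coeff-map-* : ∀ a Q i → coeff (map (a ℤ.*_) Q) i ≡ a ℤ.* coeff Q i
coeff-map-* a []      i       = sym (ℤP.*-zeroʳ a)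
coeff-map-* a (b ∷ Q) zero    = refl
coeff-map-* a (b ∷ Q) (suc i) = coeff-map-* a Q i

coeffℚ : List ℤ → ℕ → ℚ
coeffℚ P i = ℤtoℚ (coeff P i)

coeffℚ-polyMul : ∀ P Q i → coeffℚ (polyMul P Q) i ≡ conv (coeffℚ P) (coeffℚ Q) i
coeffℚ-polyMul []      Q i =
  sym (sumFrom-≡0 0 (suc i) (λ r → 0ℚ *ℚ coeffℚ Q (i ∸ r)) (λ r _ _ → ℚP.*-zeroˡ (coeffℚ Q (i ∸ r))))
coeffℚ-polyMul (a ∷ P) Q i = begin
  ℤtoℚ (coeff (polyAdd (map (a ℤ.*_) Q) (+ 0 ∷ polyMul P Q)) i)
    ≡⟨ cong ℤtoℚ (coeff-polyAdd (map (a ℤ.*_) Q) _ i) ⟩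
  ℤtoℚ (coeff (map (a ℤ.*_) Q) i ℤ.+ coeff (+ 0 ∷ polyMul P Q) i)
    ≡⟨ ℤtoℚ-+ (coeff (map (a ℤ.*_) Q) i) _ ⟩
  ℤtoℚ (coeff (map (a ℤ.*_) Q) i) +ℚ coeffℚ (+ 0 ∷ polyMul P Q) i
    ≡⟨ cong₂ _+ℚ_ (trans (cong ℤtoℚ (coeff-map-* a Q i)) (ℤtoℚ-* a (coeff Q i))) (shifted i) ⟩
  ℤtoℚ a *ℚ coeffℚ Q i +ℚ sumFrom 1 i (λ r → coeffℚ (a ∷ P) r *ℚ coeffℚ Q (i ∸ r)) ∎
  where
  open ≡-Reasoning
  shifted : ∀ i → coeffℚ (+ 0 ∷ polyMul P Q) i ≡ sumFrom 1 i (λ r → coeffℚ (a ∷ P) r *ℚ coeffℚ Q (i ∸ r))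
  shifted zero    = refl
  shifted (suc i) = trans (coeffℚ-polyMul P Q i)
    (sym (sumFrom-shift 0 (suc i) (λ r → coeffℚ (a ∷ P) r *ℚ coeffℚ Q (suc i ∸ r))))

coeff-polyMul-0 : ∀ P Q → coeff (polyMul P Q) 0 ≡ coeff P 0 ℤ.* coeff Q 0
coeff-polyMul-0 []      Q = sym (ℤP.*-zeroˡ (coeff Q 0))
coeff-polyMul-0 (a ∷ P) Q = trans (coeff-polyAdd (map (a ℤ.*_) Q) (+ 0 ∷ polyMul P Q) 0)
  (trans (ℤP.+-identityʳ (coeff (map (a ℤ.*_) Q) 0)) (coeff-map-* a Q 0))

c-zero : ∀ n → c (suc n) 0 ≡ + 2
c-zero zero    = refl
c-zero (suc n) = trans (coeff-polyAdd (polyMul (p (suc n)) (p (suc n))) (ℤ.- (+ 2) ∷ []) 0)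
  (trans (cong (ℤ._+ ℤ.- (+ 2)) (coeff-polyMul-0 (p (suc n)) (p (suc n))))
    (cong (λ x → x ℤ.* x ℤ.+ ℤ.- (+ 2)) (c-zero n)))

cℚ : ℕ → ℕ → ℚ
cℚ n i = ℤtoℚ (c n i)

cℚ-suc : ∀ n i → cℚ (suc n) (suc i) ≡ conv (cℚ n) (cℚ n) (suc i)
cℚ-suc n i = trans
  (cong ℤtoℚ (trans (coeff-polyAdd (polyMul (p n) (p n)) (ℤ.- (+ 2) ∷ []) (suc i))
                    (ℤP.+-identityʳ (coeff (polyMul (p n) (p n)) (suc i)))))
  (coeffℚ-polyMul (p n) (p n) (suc i))

cℚ-odd : ∀ n m → cℚ n (suc (2 * m)) ≡ 0ℚ
cℚ-odd zero    zero    = refl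
cℚ-odd zero    (suc m) rewrite +-suc m (m + 0) = refl
cℚ-odd (suc n) m = trans (cℚ-suc n (2 * m)) (sumFrom-≡0 0 (2 + 2 * m) _ term≡0)
  where
  term≡0 : ∀ r → 0 ≤ r → r < 2 + 2 * m → cℚ n r *ℚ cℚ n (suc (2 * m) ∸ r) ≡ 0ℚ
  term≡0 r _ r< with even⊎odd r | even⊎odd (suc (2 * m) ∸ r)
  ... | inj₂ (q , r≡2q+1) | _ = x≡0⇒x*y≡0 _ (trans (cong (cℚ n) r≡2q+1) (cℚ-odd n q))
  ... | inj₁ _ | inj₂ (q , eq) = y≡0⇒x*y≡0 (cℚ n r) (trans (cong (cℚ n) eq) (cℚ-odd n q))
  ... | inj₁ (q , r≡2q) | inj₁ (q′ , eq) = ⊥-elim (even≢odd (q + q′) m (begin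
    2 * (q + q′)                ≡⟨ *-distribˡ-+ 2 q q′ ⟩
    2 * q + 2 * q′              ≡⟨ cong₂ _+_ (sym r≡2q) (sym eq) ⟩
    r + (suc (2 * m) ∸ r)       ≡⟨ m+[n∸m]≡n (≤-pred r<) ⟩
    suc (2 * m)                 ∎))
    where open ≡-Reasoning

cℚ-degree : ∀ n i → 2 ^ suc n < i → cℚ n i ≡ 0ℚ
cℚ-degree zero    zero                ()
cℚ-degree zero    (suc zero)          (s≤s ())
cℚ-degree zero    (suc (suc zero))    (s≤s (s≤s ()))
cℚ-degree zero    (suc (suc (suc i))) _ = refl
cℚ-degree (suc n) (suc i) deg< = trans (cℚ-suc n i) (sumFrom-≡0 0 (suc (suc i)) _ term≡0)
  where
  M : ℕ
  M = 2 ^ suc n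
  term≡0 : ∀ r → 0 ≤ r → r < suc (suc i) → cℚ n r *ℚ cℚ n (suc i ∸ r) ≡ 0ℚ
  term≡0 r _ r< with r ≤? M
  ... | no  r≰M = x≡0⇒x*y≡0 (cℚ n (suc i ∸ r)) (cℚ-degree n r (≰⇒> r≰M))
  ... | yes r≤M = y≡0⇒x*y≡0 (cℚ n r) (cℚ-degree n (suc i ∸ r) M<rest)
    where
    M<rest : M < suc i ∸ r
    M<rest = +-cancelˡ-< r M (suc i ∸ r) (subst (r + M <_) (sym (m+[n∸m]≡n (≤-pred r<)))
      (≤-<-trans (+-monoˡ-≤ M r≤M) (subst (_< suc i) (cong (_+_ M) (+-identityʳ M)) deg<)))

cEven : ℕ → ℕ → ℚ
cEven n k = cℚ n (2 * k)

cEven-degree : ∀ n k → 2 ^ n < k → cEven n k ≡ 0ℚ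
cEven-degree n k 2ⁿ<k = cℚ-degree n (2 * k) (*-monoʳ-< 2 2ⁿ<k)

cEven-suc : ∀ n k → cEven (suc (suc n)) (suc k) ≡
  4ℚ *ℚ cEven (suc n) (suc k) +ℚ sumRange 1 k (λ s → cEven (suc n) s *ℚ cEven (suc n) (suc k ∸ s))
cEven-suc n k = begin
  cℚ (suc N) (2 * K)
    ≡⟨ cℚ-suc N (k + suc (k + 0)) ⟩
  conv F F (2 * K)
    ≡⟨ sumFrom-evenOdd K (λ r → F r *ℚ F (2 * K ∸ r)) ⟩
  sumFrom 0 (suc K) g +ℚ sumFrom 0 K (λ s → F (suc (2 * s)) *ℚ F (2 * K ∸ suc (2 * s)))
    ≡⟨ cong (sumFrom 0 (suc K) g +ℚ_)
         (sumFrom-≡0 0 K _ (λ s _ _ → x≡0⇒x*y≡0 (F (2 * K ∸ suc (2 * s))) (cℚ-odd N s))) ⟩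
  sumFrom 0 (suc K) g +ℚ 0ℚ
    ≡⟨ trans (ℚP.+-identityʳ _) (cong (g 0 +ℚ_) (sumFrom-last 1 k g)) ⟩
  g 0 +ℚ (sumFrom 1 k g +ℚ g K)
    ≡⟨ cong₂ (λ x y → x +ℚ (sumFrom 1 k g +ℚ y)) (cong (_*ℚ X) F0≡2)
         (trans (cong (λ i → X *ℚ F i) (n∸n≡0 (2 * K))) (cong (X *ℚ_) F0≡2)) ⟩
  2ℚ *ℚ X +ℚ (sumFrom 1 k g +ℚ X *ℚ 2ℚ)
    ≡⟨ cong (λ x → 2ℚ *ℚ X +ℚ (x +ℚ X *ℚ 2ℚ)) (sumFrom-cong 1 k (λ s _ _ →
         cong (λ i → F (2 * s) *ℚ F i) (sym (*-distribˡ-∸ 2 K s)))) ⟩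
  2ℚ *ℚ X +ℚ (S +ℚ X *ℚ 2ℚ)
    ≡⟨ solve 2 (λ x s → con 2ℚ :* x :+ (s :+ x :* con 2ℚ) := con 4ℚ :* x :+ s) refl X S ⟩
  4ℚ *ℚ X +ℚ S ∎
  where
  open ≡-Reasoning
  N : ℕ
  N = suc n
  K : ℕ
  K = suc k
  F : ℕ → ℚ
  F = cℚ N
  X : ℚ
  X = F (2 * K)
  g : ℕ → ℚ
  g s = F (2 * s) *ℚ F (2 * K ∸ 2 * s)
  S : ℚ
  S = sumRange 1 k (λ s → cEven N s *ℚ cEven N (K ∸ s))
  F0≡2 : F 0 ≡ 2ℚ
  F0≡2 = cong ℤtoℚ (c-zero n)

-- The numbers a j k

-- The recursion of the context evaluated on a itself rather than on the partial table.
module A = Row a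

table-top : ∀ m j → table (suc m) j m ≡ Row.row (table m) j m
table-top m j with m ℕ.≟ m
... | yes _   = refl
... | no  m≢m = ⊥-elim (m≢m refl)

table-below : ∀ m j k → k < m → table m j k ≡ a j k
table-below (suc m) j k k<1+m with k ℕ.≟ m
... | yes refl = sym (table-top m j)
... | no  k≢m  = table-below m j k (≤∧≢⇒< (≤-pred k<1+m) k≢m)

if-then-0-cong : ∀ (t : Bool) {x y : ℚ} → x ≡ y → (if t then x else 0ℚ) ≡ (if t then y else 0ℚ)
if-then-0-cong t refl = refl

module RowLocal {P P′ : ℕ → ℕ → ℚ} {k : ℕ} (1≤k : 1 ≤ k)
                (P≗P′ : ∀ j k′ → k′ < k → P j k′ ≡ P′ j k′) where

  private
    half-k<k : half k < k
    half-k<k = half-< k 1≤k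

  sqTerm-local : ∀ j → Row.sqTerm P j k ≡ Row.sqTerm P′ j k
  sqTerm-local j = if-then-0-cong (isEven j ∧ isEven k)
    (cong₂ _*ℚ_ (P≗P′ (half j) (half k) half-k<k) (P≗P′ (half j) (half k) half-k<k))

  u-local : ∀ j → Row.u P j k ≡ Row.u P′ j k
  u-local j = if-then-0-cong (isEven k ∧ leq 3 j ∧ leq j (k ∸ 1)) (cong (2ℚ *ℚ_)
    (sumRange-cong (1 ⊔ (j ∸ half k)) (half (j ∸ 1) ⊓ (half k ∸ 1)) (λ l _ _ →
      cong₂ _*ℚ_ (P≗P′ l (half k) half-k<k) (P≗P′ (j ∸ l) (half k) half-k<k))))

  v-local : ∀ σ j → Row.v P σ j k ≡ Row.v P′ σ j k
  v-local σ j = sumRange-cong σ (half (k ∸ 1)) λ s _ s≤ →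
    sumRange-cong (1 ⊔ ((j + s) ∸ k)) ((j ∸ 1) ⊓ s) λ r lo≤r r≤hi →
      let s<k : s < k
          s<k = ≤-<-trans s≤ (≤-<-trans (half-≤ (k ∸ 1)) (∸-monoʳ-< z<s 1≤k))
          0<s : 0 < s
          0<s = ≤-trans (≤-trans (m≤m⊔n 1 ((j + s) ∸ k)) lo≤r) (≤-trans r≤hi (m⊓n≤n (j ∸ 1) s))
      in cong₂ _*ℚ_ (P≗P′ r s s<k) (P≗P′ (j ∸ r) (k ∸ s) (∸-monoʳ-< 0<s (<⇒≤ s<k)))

  w-local : ∀ σ j → Row.w P σ j k ≡ Row.w P′ σ j k
  w-local σ j = cong₂ _+ℚ_ (cong₂ _+ℚ_ (sqTerm-local j) (u-local j)) (cong (2ℚ *ℚ_) (v-local σ j))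

  aHigh-local : ∀ j → Row.aHigh P j k ≡ Row.aHigh P′ j k
  aHigh-local j = cong (b j *ℚ_) (w-local 0 j)

  aOne-local : Row.aOne P k ≡ Row.aOne P′ k
  aOne-local = sumRange-cong 2 k λ l _ _ →
    cong (_*ℚ ℕtoℚ (2 ^ (2 * η k * (l ∸ 1))))
      (cong₂ _-ℚ_ (cong (inv4^ l *ℚ_) (w-local (Row.σₖ P k) l)) (aHigh-local l))

row-cases : (ℕ → ℕ → ℚ) → ℕ → ℕ → Bool → ℚ
row-cases P j K j≤K = if j≤K then (if leq 2 j then Row.aHigh P j K else Row.aOne P K) else 0ℚ

a-suc-suc : ∀ j k → 1 ≤ j → a j (2 + k) ≡ row-cases (table (2 + k)) j (2 + k) (leq j (2 + k))
a-suc-suc (suc zero)    k _ = table-top (2 + k) 1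
a-suc-suc (suc (suc j)) k _ = table-top (2 + k) (2 + j)

a-zero-index : ∀ k → a 0 k ≡ 0ℚ
a-zero-index zero    = refl
a-zero-index (suc k) = table-top (suc k) 0

a-above : ∀ j k → k < j → a j k ≡ 0ℚ
a-above j             zero          _   = refl
a-above (suc (suc j)) (suc zero)    _   = refl
a-above (suc zero)    (suc zero)    (s≤s ())
a-above (suc j)       (suc (suc k)) k<j =
  trans (a-suc-suc (suc j) k (s≤s z≤n)) (cong (row-cases (table (2 + k)) (suc j) (2 + k)) (leq-false k<j))

a-high : ∀ j k → 2 ≤ j → j ≤ k → a j k ≡ A.aHigh j k
a-high (suc zero)    _             (s≤s ()) _
a-high (suc (suc j)) (suc zero)    _ (s≤s ())
a-high (suc (suc j)) (suc (suc k)) _ j≤k = begin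
  a (2 + j) (2 + k)
    ≡⟨ a-suc-suc (2 + j) k (s≤s z≤n) ⟩
  row-cases (table (2 + k)) (2 + j) (2 + k) (leq (2 + j) (2 + k))
    ≡⟨ cong (row-cases (table (2 + k)) (2 + j) (2 + k)) (leq-true j≤k) ⟩
  Row.aHigh (table (2 + k)) (2 + j) (2 + k)
    ≡⟨ RowLocal.aHigh-local (s≤s z≤n) (table-below (2 + k)) (2 + j) ⟩
  A.aHigh (2 + j) (2 + k) ∎
  where open ≡-Reasoning

a-one : ∀ k → 2 ≤ k → a 1 k ≡ A.aOne k
a-one (suc zero)    (s≤s ())
a-one (suc (suc k)) _ = trans (a-suc-suc 1 k (s≤s z≤n))
  (RowLocal.aOne-local (s≤s z≤n) (table-below (2 + k)))

w-at-1 : ∀ σ k → A.w σ 1 k ≡ 0ℚ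
w-at-1 σ k = cong₂ (λ x y → 0ℚ +ℚ x +ℚ 2ℚ *ℚ y) u≡0 v≡0
  where
  u≡0 : A.u 1 k ≡ 0ℚ
  u≡0 = cong (λ t → if t then 2ℚ *ℚ sumRange (1 ⊔ (1 ∸ half k)) (0 ⊓ (half k ∸ 1))
                                  (λ r → a r (half k) *ℚ a (1 ∸ r) (half k)) else 0ℚ)
             (∧-zeroʳ (isEven k))
  v≡0 : A.v σ 1 k ≡ 0ℚ
  v≡0 = sumRange-≡0 σ (half (k ∸ 1)) _ (λ s _ _ →
          sumRange-empty (1 ⊔ ((1 + s) ∸ k)) 0 (λ r → a r s *ℚ a (1 ∸ r) (k ∸ s)) (m≤m⊔n 1 ((1 + s) ∸ k)))

sqTerm-odd : ∀ j k → isEven k ≡ false → A.sqTerm j k ≡ 0ℚ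
sqTerm-odd j k k-odd rewrite k-odd =
  cong (λ t → if t then a (half j) (half k) *ℚ a (half j) (half k) else 0ℚ) (∧-zeroʳ (isEven j))

u-odd : ∀ j k → isEven k ≡ false → A.u j k ≡ 0ℚ
u-odd j k k-odd rewrite k-odd = refl

-- Products of the polynomials Q k

Q : ℕ → ℚ → ℚ
Q k Y = sumRange 1 k (λ j → a j k *ℚ Y ^ℚ j)

W : ℕ → ℕ → ℚ → ℚ
W σ k Y = sumRange 1 k (λ l → A.w σ l k *ℚ Y ^ℚ l)

Q-eval : ∀ k Y → Q k Y ≡ eval (λ j → a j k) k Y
Q-eval k Y = sym (eval-from-1 (λ j → a j k) k Y (a-zero-index k))

rowConv : ℕ → ℕ → ℕ → ℚ
rowConv s t = conv (λ r → a r s) (λ r → a r t)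

Q-* : ∀ s t Y → Q s Y *ℚ Q t Y ≡ eval (rowConv s t) (s + t) Y
Q-* s t Y = trans (cong₂ _*ℚ_ (Q-eval s Y) (Q-eval t Y))
  (eval-* (λ r → a r s) (λ r → a r t) s t Y (λ i → a-above i s) (λ i → a-above i t))

rowConv-support : ∀ s t l → rowConv s t l ≡ sumRange (1 ⊔ (l ∸ t)) ((l ∸ 1) ⊓ s) (λ r → a r s *ℚ a (l ∸ r) t)
rowConv-support s t l = sumRange-restrict 0 l (1 ⊔ (l ∸ t)) ((l ∸ 1) ⊓ s) _ z≤n
  (≤-trans (m⊓n≤m (l ∸ 1) s) (m∸n≤m l 1)) outside
  where
  outside : ∀ i → 0 ≤ i → i ≤ l → i < 1 ⊔ (l ∸ t) ⊎ (l ∸ 1) ⊓ s < i → a i s *ℚ a (l ∸ i) t ≡ 0ℚ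
  outside zero    _ _ _ = x≡0⇒x*y≡0 (a l t) (a-zero-index s)
  outside (suc i) _ _ (inj₁ i<lo) =
    y≡0⇒x*y≡0 (a (suc i) s) (a-above (l ∸ suc i) t (<∸-swap (1+i<1⊔x⇒1+i<x (l ∸ t) i<lo)))
  outside (suc i) _ i≤l (inj₂ hi<i) with suc i ≤? s
  ... | no  i≰s = x≡0⇒x*y≡0 (a (l ∸ suc i) t) (a-above (suc i) s (≰⇒> i≰s))
  ... | yes i≤s = y≡0⇒x*y≡0 (a (suc i) s) (trans (cong (λ r → a r t) l∸i≡0) (a-zero-index t))
    where
    l∸i≡0 : l ∸ suc i ≡ 0
    l∸i≡0 = m≤n⇒m∸n≡0 (m∸1<n⇒m≤n {l} (≰⇒> (λ i<l∸1 → <⇒≱ hi<i (⊓-glb i<l∸1 i≤s))))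

-- For even k, the middle term s = k/2 of Σ_s rowConv s (k ∸ s) l; folding it at r = l/2 gives
-- ε(l) a²_{l/2,k/2} and u(l,k).
module CentralTerm (k : ℕ) (k-even : isEven k ≡ true) (l′ : ℕ) (l≤k : suc l′ ≤ k) where

  private
    l h lo hi : ℕ
    l  = suc l′
    h  = half k
    lo = 1 ⊔ (l ∸ h)
    hi = half l′ ⊓ (h ∸ 1)
    g : ℕ → ℚ
    g r = a r h *ℚ a (l ∸ r) h
    h+h≡k : h + h ≡ k
    h+h≡k = half+half≡ k k-even

  halfConv-support : sumRange 0 (half l′) g ≡ sumRange lo hi g
  halfConv-support = sumRange-restrict 0 (half l′) lo hi g z≤n (m⊓n≤m (half l′) (h ∸ 1)) outside
    where
    outside : ∀ i → 0 ≤ i → i ≤ half l′ → i < lo ⊎ hi < i → g i ≡ 0ℚ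
    outside zero    _ _ _ = x≡0⇒x*y≡0 (a l h) (a-zero-index h)
    outside (suc i) _ _ (inj₁ i<lo) =
      y≡0⇒x*y≡0 (a (suc i) h) (a-above (l ∸ suc i) h (<∸-swap (1+i<1⊔x⇒1+i<x (l ∸ h) i<lo)))
    outside (suc i) _ i≤ (inj₂ hi<i) with h ≤? suc i
    ... | no  h≰i = ⊥-elim (<⇒≱ hi<i (⊓-glb i≤ (m<n⇒m≤n∸1 (≰⇒> h≰i))))
      where
      m<n⇒m≤n∸1 : ∀ {m n} → m < n → m ≤ n ∸ 1
      m<n⇒m≤n∸1 (s≤s m≤n) = m≤n
    ... | yes h≤i = y≡0⇒x*y≡0 (a (suc i) h) (a-above (l ∸ suc i) h (<∸-swap (m+n≤o⇒m≤o∸n (suc (suc i)) (s≤s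
          (≤-trans (+-monoʳ-≤ (suc i) h≤i) (≤-trans (+-mono-≤ i≤ i≤) (half+half≤ l′)))))))

  private
    X : ℚ
    X = 2ℚ *ℚ sumRange lo hi g

    X-empty : hi < lo → X ≡ 0ℚ
    X-empty hi<lo = y≡0⇒x*y≡0 2ℚ (sumRange-empty lo hi g hi<lo)

    hi<lo-if-small : l < 3 → hi < lo
    hi<lo-if-small l<3 = subst (λ x → x ⊓ (h ∸ 1) < lo) (sym (half≤1≡0 (≤-pred (≤-pred l<3)))) (m≤m⊔n 1 (l ∸ h))
      where
      half≤1≡0 : ∀ {m} → m ≤ 1 → half m ≡ 0
      half≤1≡0 z≤n       = refl
      half≤1≡0 (s≤s z≤n) = refl

    hi<lo-if-top : k ∸ 1 < l → hi < lo
    hi<lo-if-top k∸1<l = begin-strict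
      hi            ≤⟨ m⊓n≤n (half l′) (h ∸ 1) ⟩
      h ∸ 1         <⟨ ∸-monoʳ-< z<s 1≤h ⟩
      h             ≡⟨ sym (trans (cong (_∸ h) (trans l≡k (sym h+h≡k))) (m+n∸m≡n h h)) ⟩
      l ∸ h         ≤⟨ m≤n⊔m 1 (l ∸ h) ⟩
      lo            ∎
      where
      open ≤-Reasoning
      l≡k : l ≡ k
      l≡k = ≤-antisym l≤k (m∸1<n⇒m≤n k∸1<l)
      1≤h : 1 ≤ h
      1≤h = n≢0⇒n>0 λ h≡0 → <⇒≱ (≤-trans (s≤s z≤n) l≤k) (≤-reflexive (trans (sym h+h≡k) (cong (λ x → x + x) h≡0)))

    in-range : (if leq 3 l ∧ leq l (k ∸ 1) then X else 0ℚ) ≡ X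
    in-range with leq 3 l in e₁ | leq l (k ∸ 1) in e₂
    ... | true  | true  = refl
    ... | false | _     = sym (X-empty (hi<lo-if-small (leq-false⁻ e₁)))
    ... | true  | false = sym (X-empty (hi<lo-if-top (leq-false⁻ e₂)))

  u≡halfConv : A.u l k ≡ 2ℚ *ℚ sumRange 0 (half l′) g
  u≡halfConv = begin
    A.u l k                                        ≡⟨ cong (λ t → if t ∧ leq 3 l ∧ leq l (k ∸ 1) then X else 0ℚ) k-even ⟩
    (if leq 3 l ∧ leq l (k ∸ 1) then X else 0ℚ)    ≡⟨ in-range ⟩
    X                                              ≡⟨ cong (2ℚ *ℚ_) (sym halfConv-support) ⟩
    2ℚ *ℚ sumRange 0 (half l′) g                   ∎
    where open ≡-Reasoning

  rowConv-central : rowConv h h l ≡ A.sqTerm l k +ℚ A.u l k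
  rowConv-central = begin
    rowConv h h l                                           ≡⟨ conv-self (λ r → a r h) l ⟩
    2ℚ *ℚ sumRange 0 (half l′) g +ℚ M                       ≡⟨ cong₂ _+ℚ_ (sym u≡halfConv) M≡sqTerm ⟩
    A.u l k +ℚ A.sqTerm l k                                 ≡⟨ ℚP.+-comm (A.u l k) (A.sqTerm l k) ⟩
    A.sqTerm l k +ℚ A.u l k                                 ∎
    where
    open ≡-Reasoning
    M : ℚ
    M = if isEven l then a (half l) h *ℚ a (half l) h else 0ℚ
    M≡sqTerm : M ≡ A.sqTerm l k
    M≡sqTerm = cong (λ t → if t then a (half l) h *ℚ a (half l) h else 0ℚ)
      (trans (sym (∧-identityʳ (isEven l))) (cong (isEven l ∧_) (sym k-even)))

-- Pairing s with k ∸ s folds Σ_{s=σ}^{k-σ} rowConv s (k ∸ s) l into 2 v_σ(l,k) plus the central term.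
module RowConvSum (k σ : ℕ) (σ+σ≤k : σ + σ ≤ k) (l′ : ℕ) (l≤k : suc l′ ≤ k) where

  private
    l : ℕ
    l = suc l′
    d : ℕ
    d = k ∸ (σ + σ)
    k≡ : σ + (σ + d) ≡ k
    k≡ = trans (sym (+-assoc σ σ d)) (m+[n∸m]≡n σ+σ≤k)
    f : ℕ → ℚ
    f s = rowConv s (k ∸ s) l

    f-sym : ∀ i → i ≤ d → f (σ + i) ≡ f (σ + (d ∸ i))
    f-sym i i≤d = trans (conv-comm (λ r → a r (σ + i)) (λ r → a r (k ∸ (σ + i))) l)
      (cong₂ (λ s t → rowConv s t l) k∸[σ+i]≡ (sym (trans (cong (k ∸_) (sym k∸[σ+i]≡)) (m∸[m∸n]≡n σ+i≤k))))
      where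
      σ+i≤k : σ + i ≤ k
      σ+i≤k = subst (σ + i ≤_) k≡ (+-monoʳ-≤ σ (≤-trans i≤d (m≤n+m d σ)))
      k∸[σ+i]≡ : k ∸ (σ + i) ≡ σ + (d ∸ i)
      k∸[σ+i]≡ = trans (cong (_∸ (σ + i)) (sym k≡)) (trans ([m+n]∸[m+o]≡n∸o σ (σ + d) i) (+-∸-assoc σ i≤d))

    half-k≡ : half k ≡ σ + half d
    half-k≡ = trans (cong half (sym k≡)) (half-+-double σ d)

    isEven-k≡ : isEven k ≡ isEven d
    isEven-k≡ = trans (cong isEven (sym k≡)) (isEven-+-double σ d)

    pairs≡v : sumFrom σ (half (suc d)) f ≡ A.v σ l k
    pairs≡v = sym (begin
      sumFrom σ (suc (half (k ∸ 1)) ∸ σ) inner  ≡⟨ cong (λ n → sumFrom σ n inner) length ⟩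
      sumFrom σ (half (suc d)) inner             ≡⟨ sumFrom-cong σ (half (suc d)) (λ s _ s< → inner≡f s s<) ⟩
      sumFrom σ (half (suc d)) f                 ∎)
      where
      open ≡-Reasoning
      inner : ℕ → ℚ
      inner s = sumRange (1 ⊔ ((l + s) ∸ k)) ((l ∸ 1) ⊓ s) (λ r → a r s *ℚ a (l ∸ r) (k ∸ s))
      half-1+k≡ : half (suc k) ≡ σ + half (suc d)
      half-1+k≡ = trans (cong half (trans (cong suc (sym k≡)) (sym (trans (cong (_+_ σ) (+-suc σ d)) (+-suc σ (σ + d))))))
                        (half-+-double σ (suc d))
      length : suc (half (k ∸ 1)) ∸ σ ≡ half (suc d)
      length = trans (cong (_∸ σ) (trans (half-suc-pred k 1≤k) half-1+k≡)) (m+n∸m≡n σ (half (suc d)))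
        where
        1≤k : 1 ≤ k
        1≤k = ≤-trans (s≤s z≤n) l≤k
        half-suc-pred : ∀ k → 1 ≤ k → suc (half (k ∸ 1)) ≡ half (suc k)
        half-suc-pred (suc k) _ = refl
      inner≡f : ∀ s → s < σ + half (suc d) → inner s ≡ f s
      inner≡f s s< = sym (trans (rowConv-support s (k ∸ s) l)
        (cong (λ x → sumRange (1 ⊔ x) ((l ∸ 1) ⊓ s) (λ r → a r s *ℚ a (l ∸ r) (k ∸ s))) (sym (+-∸-comm-∸ l s≤k))))
        where
        s≤k : s ≤ k
        s≤k = ≤-pred (<-≤-trans s< (≤-trans (≤-reflexive (sym half-1+k≡)) (half-≤ (suc k))))

    middle≡ : (if isEven d then f (σ + half d) else 0ℚ) ≡ A.sqTerm l k +ℚ A.u l k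
    middle≡ with isEven d in d-even
    ... | true  = trans
      (cong₂ (λ s t → rowConv s t l) (sym half-k≡) (trans (cong (k ∸_) (sym half-k≡)) (∸half≡half k k-even)))
      (CentralTerm.rowConv-central k k-even l′ l≤k)
      where
      k-even : isEven k ≡ true
      k-even = trans isEven-k≡ d-even
    ... | false = sym (trans (cong₂ _+ℚ_ (sqTerm-odd l k k-odd) (u-odd l k k-odd)) (ℚP.+-identityˡ 0ℚ))
      where
      k-odd : isEven k ≡ false
      k-odd = trans isEven-k≡ d-even

  rowConv-sum : sumRange σ (k ∸ σ) f ≡ A.w σ l k
  rowConv-sum = begin
    sumFrom σ (suc (k ∸ σ) ∸ σ) f                            ≡⟨ cong (λ n → sumFrom σ n f) length ⟩
    sumFrom σ (suc d) f                                      ≡⟨ sumFrom-pairs d σ f f-sym ⟩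
    2ℚ *ℚ sumFrom σ (half (suc d)) f +ℚ (if isEven d then f (σ + half d) else 0ℚ)
                                                             ≡⟨ cong₂ (λ x y → 2ℚ *ℚ x +ℚ y) pairs≡v middle≡ ⟩
    2ℚ *ℚ A.v σ l k +ℚ (A.sqTerm l k +ℚ A.u l k)            ≡⟨ ℚP.+-comm (2ℚ *ℚ A.v σ l k) _ ⟩
    A.w σ l k                                                ∎
    where
    open ≡-Reasoning
    length : suc (k ∸ σ) ∸ σ ≡ suc d
    length = trans (cong (λ x → suc (x ∸ σ) ∸ σ) (sym k≡))
      (trans (cong (λ x → suc x ∸ σ) (m+n∸m≡n σ (σ + d))) (trans (cong (_∸ σ) (sym (+-suc σ d))) (m+n∸m≡n σ (suc d))))

Q-products-sum : ∀ k σ Y → σ + σ ≤ k → sumRange σ (k ∸ σ) (λ s → Q s Y *ℚ Q (k ∸ s) Y) ≡ W σ k Y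
Q-products-sum k σ Y σ+σ≤k = begin
  sumRange σ (k ∸ σ) (λ s → Q s Y *ℚ Q (k ∸ s) Y)
    ≡⟨ sumRange-cong σ (k ∸ σ) (λ s _ s≤ → trans (Q-* s (k ∸ s) Y)
         (cong (λ d → eval (rowConv s (k ∸ s)) d Y) (m+[n∸m]≡n (≤-trans s≤ (m∸n≤m k σ))))) ⟩
  sumRange σ (k ∸ σ) (λ s → eval (rowConv s (k ∸ s)) k Y)
    ≡⟨ sumFrom-eval σ (suc (k ∸ σ) ∸ σ) (λ s → rowConv s (k ∸ s)) k Y ⟩
  eval (λ l → sumRange σ (k ∸ σ) (λ s → rowConv s (k ∸ s) l)) k Y
    ≡⟨ eval-from-1 (λ l → sumRange σ (k ∸ σ) (λ s → rowConv s (k ∸ s) l)) k Y (sumRange-≡0 σ (k ∸ σ) _ (λ s _ _ →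
         trans (ℚP.+-identityʳ _) (x≡0⇒x*y≡0 (a 0 (k ∸ s)) (a-zero-index s)))) ⟩
  sumRange 1 k (λ l → sumRange σ (k ∸ σ) (λ s → rowConv s (k ∸ s) l) *ℚ Y ^ℚ l)
    ≡⟨ sumRange-cong 1 k (λ { (suc l′) _ l≤k →
         cong (_*ℚ Y ^ℚ suc l′) (RowConvSum.rowConv-sum k σ σ+σ≤k l′ l≤k) }) ⟩
  W σ k Y ∎
  where open ≡-Reasoning

-- Replacing Y by 4 Y

b-inverse : ∀ i → b (2 + i) *ℚ ℕtoℚ (4 * (4 ^ suc i ∸ 1)) ≡ 1ℚ
b-inverse i = /-*-cancel (4 * (4 ^ suc i ∸ 1)) {{m*n≢0 4 (4 ^ suc i ∸ 1) {{_}} {{4^suc-1-nonZero i}}}} (+ 1)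

4^-split : ∀ i → 4ℚ ^ℚ (2 + i) ≡ ℕtoℚ (4 * (4 ^ suc i ∸ 1)) +ℚ 4ℚ
4^-split i = begin
  4ℚ ^ℚ (2 + i)                         ≡⟨ sym (ℕtoℚ-^ 4 (2 + i)) ⟩
  ℕtoℚ (4 ^ (2 + i))                    ≡⟨ cong ℕtoℚ (sym (m∸n+n≡m (*-monoʳ-≤ 4 (m^n>0 4 (suc i))))) ⟩
  ℕtoℚ (4 * 4 ^ suc i ∸ 4 + 4)          ≡⟨ cong (λ n → ℕtoℚ (n + 4)) (sym (*-distribˡ-∸ 4 (4 ^ suc i) 1)) ⟩
  ℕtoℚ (4 * (4 ^ suc i ∸ 1) + 4)        ≡⟨ ℕtoℚ-+ (4 * (4 ^ suc i ∸ 1)) 4 ⟩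
  ℕtoℚ (4 * (4 ^ suc i ∸ 1)) +ℚ 4ℚ      ∎
  where open ≡-Reasoning

a-scale : ∀ l k Y → 1 ≤ l → l ≤ k →
  a l k *ℚ (4ℚ *ℚ Y) ^ℚ l ≡ 4ℚ *ℚ (a l k *ℚ Y ^ℚ l) +ℚ A.w 0 l k *ℚ Y ^ℚ l
a-scale (suc zero) k Y _ _ = begin
  a 1 k *ℚ (4ℚ *ℚ Y *ℚ 1ℚ)
    ≡⟨ solve 2 (λ x y → x :* (con 4ℚ :* y :* con 1ℚ) := con 4ℚ :* (x :* (y :* con 1ℚ)) :+ con 0ℚ :* (y :* con 1ℚ))
         refl (a 1 k) Y ⟩
  4ℚ *ℚ (a 1 k *ℚ (Y *ℚ 1ℚ)) +ℚ 0ℚ *ℚ (Y *ℚ 1ℚ)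
    ≡⟨ cong (λ x → 4ℚ *ℚ (a 1 k *ℚ (Y *ℚ 1ℚ)) +ℚ x *ℚ (Y *ℚ 1ℚ)) (sym (w-at-1 0 k)) ⟩
  4ℚ *ℚ (a 1 k *ℚ (Y *ℚ 1ℚ)) +ℚ A.w 0 1 k *ℚ (Y *ℚ 1ℚ) ∎
  where open ≡-Reasoning
a-scale l@(suc (suc i)) k Y _ l≤k = begin
  a l k *ℚ (4ℚ *ℚ Y) ^ℚ l
    ≡⟨ cong (a l k *ℚ_) (trans (^-distrib-* 4ℚ Y l) (cong (_*ℚ Y ^ℚ l) (4^-split i))) ⟩
  a l k *ℚ ((B +ℚ 4ℚ) *ℚ Y ^ℚ l)
    ≡⟨ solve 3 (λ x b y → x :* ((b :+ con 4ℚ) :* y) := con 4ℚ :* (x :* y) :+ x :* b :* y) refl (a l k) B (Y ^ℚ l) ⟩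
  4ℚ *ℚ (a l k *ℚ Y ^ℚ l) +ℚ a l k *ℚ B *ℚ Y ^ℚ l
    ≡⟨ cong (λ x → 4ℚ *ℚ (a l k *ℚ Y ^ℚ l) +ℚ x *ℚ Y ^ℚ l) a*B≡w ⟩
  4ℚ *ℚ (a l k *ℚ Y ^ℚ l) +ℚ A.w 0 l k *ℚ Y ^ℚ l ∎
  where
  open ≡-Reasoning
  B : ℚ
  B = ℕtoℚ (4 * (4 ^ suc i ∸ 1))
  a*B≡w : a l k *ℚ B ≡ A.w 0 l k
  a*B≡w = begin
    a l k *ℚ B                ≡⟨ cong (_*ℚ B) (a-high l k (s≤s (s≤s z≤n)) l≤k) ⟩
    b l *ℚ A.w 0 l k *ℚ B     ≡⟨ solve 3 (λ x w y → x :* w :* y := x :* y :* w) refl (b l) (A.w 0 l k) B ⟩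
    b l *ℚ B *ℚ A.w 0 l k     ≡⟨ cong (_*ℚ A.w 0 l k) (b-inverse i) ⟩
    1ℚ *ℚ A.w 0 l k           ≡⟨ ℚP.*-identityˡ (A.w 0 l k) ⟩
    A.w 0 l k                 ∎

Q-scale : ∀ k Y → Q k (4ℚ *ℚ Y) ≡ 4ℚ *ℚ Q k Y +ℚ W 0 k Y
Q-scale k Y = trans (sumRange-cong 1 k (λ l 1≤l l≤k → a-scale l k Y 1≤l l≤k))
  (trans (sumFrom-+ 1 k (λ l → 4ℚ *ℚ (a l k *ℚ Y ^ℚ l)) (λ l → A.w 0 l k *ℚ Y ^ℚ l))
    (cong (_+ℚ W 0 k Y) (sumFrom-*ˡ 1 k 4ℚ (λ l → a l k *ℚ Y ^ℚ l))))

-- The exponent η k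

η-upper : ∀ k → k ≤ 2 ^ η k
η-upper = <-rec (λ k → k ≤ 2 ^ η k) upper
  where
  upper : ∀ k → (∀ {j} → j < k → j ≤ 2 ^ η j) → k ≤ 2 ^ η k
  upper zero          _  = z≤n
  upper (suc zero)    _  = s≤s z≤n
  upper k@(suc (suc n)) IH = begin
    k                             ≡⟨ sym (⌊n/2⌋+⌈n/2⌉≡n k) ⟩
    ℕ.⌊ k /2⌋ + h                 ≤⟨ +-monoˡ-≤ h (⌊n/2⌋≤⌈n/2⌉ k) ⟩
    h + h                         ≤⟨ +-mono-≤ h≤ h≤ ⟩
    2 ^ η h + 2 ^ η h             ≡⟨ cong (λ e → 2 ^ e + 2 ^ e) (⌈log₂⌈n/2⌉⌉≡⌈log₂n⌉∸1 k) ⟩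
    2 ^ (η k ∸ 1) + 2 ^ (η k ∸ 1) ≡⟨ cong (_+_ (2 ^ (η k ∸ 1))) (sym (+-identityʳ (2 ^ (η k ∸ 1)))) ⟩
    2 ^ suc (η k ∸ 1)             ≡⟨ cong (2 ^_) (trans (+-comm 1 (η k ∸ 1)) (m∸n+n≡m (⌈log₂⌉-mono-≤ {2} {k} (s≤s (s≤s z≤n))))) ⟩
    2 ^ η k                       ∎
    where
    open ≤-Reasoning
    h = ℕ.⌈ k /2⌉
    h≤ : h ≤ 2 ^ η h
    h≤ = IH (⌈n/2⌉<n n)

η-lower : ∀ k → 2 ≤ k → 2 ^ (η k ∸ 1) < k
η-lower k 2≤k = ≰⇒> λ k≤2^[η∸1] → <⇒≱ (∸-monoʳ-< z<s (⌈log₂⌉-mono-≤ 2≤k))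
  (subst (η k ≤_) (⌈log₂2^n⌉≡n (η k ∸ 1)) (⌈log₂⌉-mono-≤ k≤2^[η∸1]))

-- Induction on k

Formula : ℕ → ℕ → Set
Formula n k = cEven n k ≡ Q k (4ℚ ^ℚ n)

FormulaBelow : ℕ → Set
FormulaBelow k = ∀ s → 1 ≤ s → s < k → ∀ n → 1 ≤ n → Formula n s

inner-products-sum : ∀ k Y → sumRange 1 k (λ s → Q s Y *ℚ Q (suc k ∸ s) Y) ≡ W 0 (suc k) Y
inner-products-sum k Y = trans (sym ends) (Q-products-sum (suc k) 0 Y z≤n)
  where
  f : ℕ → ℚ
  f s = Q s Y *ℚ Q (suc k ∸ s) Y
  ends : sumFrom 0 (suc (suc k)) f ≡ sumRange 1 k f
  ends = begin
    f 0 +ℚ sumFrom 1 (suc k) f             ≡⟨ cong (f 0 +ℚ_) (sumFrom-last 1 k f) ⟩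
    f 0 +ℚ (sumFrom 1 k f +ℚ f (suc k))    ≡⟨ cong₂ (λ x y → x +ℚ (sumFrom 1 k f +ℚ y)) (ℚP.*-zeroˡ (Q (suc k) Y))
                                                (y≡0⇒x*y≡0 (Q (suc k) Y) (cong (λ j → Q j Y) (n∸n≡0 k))) ⟩
    0ℚ +ℚ (sumFrom 1 k f +ℚ 0ℚ)            ≡⟨ trans (ℚP.+-identityˡ _) (ℚP.+-identityʳ _) ⟩
    sumFrom 1 k f                          ∎
    where open ≡-Reasoning

defect : ℕ → ℕ → ℚ
defect n k = cEven n k -ℚ Q k (4ℚ ^ℚ n)

defect-suc : ∀ n k → FormulaBelow (suc k) → defect (2 + n) (suc k) ≡ 4ℚ *ℚ defect (suc n) (suc k)
defect-suc n k IH = begin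
  cEven (2 + n) K -ℚ Q K (4ℚ *ℚ Y)
    ≡⟨ cong₂ _-ℚ_ (cEven-suc n k) (Q-scale K Y) ⟩
  4ℚ *ℚ cEven (suc n) K +ℚ sumRange 1 k (λ s → cEven (suc n) s *ℚ cEven (suc n) (K ∸ s)) -ℚ (4ℚ *ℚ Q K Y +ℚ W 0 K Y)
    ≡⟨ cong (λ x → 4ℚ *ℚ cEven (suc n) K +ℚ x -ℚ (4ℚ *ℚ Q K Y +ℚ W 0 K Y))
         (trans (sumRange-cong 1 k by-IH) (inner-products-sum k Y)) ⟩
  4ℚ *ℚ cEven (suc n) K +ℚ W 0 K Y -ℚ (4ℚ *ℚ Q K Y +ℚ W 0 K Y)
    ≡⟨ solve 3 (λ c w q → con 4ℚ :* c :+ w :- (con 4ℚ :* q :+ w) := con 4ℚ :* (c :- q))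
         refl (cEven (suc n) K) (W 0 K Y) (Q K Y) ⟩
  4ℚ *ℚ (cEven (suc n) K -ℚ Q K Y) ∎
  where
  open ≡-Reasoning
  K : ℕ
  K = suc k
  Y : ℚ
  Y = 4ℚ ^ℚ suc n
  by-IH : ∀ s → 1 ≤ s → s ≤ k → cEven (suc n) s *ℚ cEven (suc n) (K ∸ s) ≡ Q s Y *ℚ Q (K ∸ s) Y
  by-IH s 1≤s s≤k = cong₂ _*ℚ_ (IH s 1≤s (s≤s s≤k) (suc n) (s≤s z≤n))
    (IH (K ∸ s) (m<n⇒0<n∸m (s≤s s≤k)) (∸-monoʳ-< 1≤s (m≤n⇒m≤1+n s≤k)) (suc n) (s≤s z≤n))

Formula⇒defect≡0 : ∀ {n k} → Formula n k → defect n k ≡ 0ℚ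
Formula⇒defect≡0 {n} {k} eq = trans (cong (_-ℚ Q k (4ℚ ^ℚ n)) eq) (ℚP.+-inverseʳ (Q k (4ℚ ^ℚ n)))

defect≡0⇒Formula : ∀ {n k} → defect n k ≡ 0ℚ → Formula n k
defect≡0⇒Formula {n} {k} = x∙y⁻¹≈ε⇒x≈y (cEven n k) (Q k (4ℚ ^ℚ n))

defect-geometric : ∀ k → FormulaBelow (suc k) → ∀ n → defect (suc n) (suc k) ≡ 4ℚ ^ℚ n *ℚ defect 1 (suc k)
defect-geometric k IH zero    = sym (ℚP.*-identityˡ (defect 1 (suc k)))
defect-geometric k IH (suc n) = trans (defect-suc n k IH)
  (trans (cong (4ℚ *ℚ_) (defect-geometric k IH n)) (sym (ℚP.*-assoc 4ℚ (4ℚ ^ℚ n) (defect 1 (suc k)))))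

formula-propagates : ∀ k → FormulaBelow (suc k) →
  ∀ n₀ → 1 ≤ n₀ → Formula n₀ (suc k) → ∀ n → 1 ≤ n → Formula n (suc k)
formula-propagates k IH (suc n₀) _ base (suc n) _ = defect≡0⇒Formula {suc n} {suc k}
  (trans (defect-geometric k IH n) (y≡0⇒x*y≡0 (4ℚ ^ℚ n) defect₁≡0))
  where
  defect₁≡0 : defect 1 (suc k) ≡ 0ℚ
  defect₁≡0 = ℕtoℚ[m]*x≡0⇒x≡0 (4 ^ n₀) {{m^n≢0 4 n₀}} (defect 1 (suc k)) (begin
    ℕtoℚ (4 ^ n₀) *ℚ defect 1 (suc k)  ≡⟨ cong (_*ℚ defect 1 (suc k)) (ℕtoℚ-^ 4 n₀) ⟩
    4ℚ ^ℚ n₀ *ℚ defect 1 (suc k)       ≡⟨ sym (defect-geometric k IH n₀) ⟩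
    defect (suc n₀) (suc k)            ≡⟨ Formula⇒defect≡0 {suc n₀} {suc k} base ⟩
    0ℚ                                 ∎)
    where open ≡-Reasoning

cEven-first-level : ∀ m k → 1 ≤ m → 2 ^ m < k → k ≤ 2 ^ suc m → (∀ s → 1 ≤ s → s < k → Formula m s) →
  cEven (suc m) k ≡ W (k ∸ 2 ^ m) k (4ℚ ^ℚ m)
cEven-first-level (suc m′) (suc k′) _ M<k k≤2M IH = begin
  cEven (2 + m′) k                                     ≡⟨ cEven-suc m′ k′ ⟩
  4ℚ *ℚ cEven m k +ℚ sumRange 1 k′ h                   ≡⟨ cong₂ (λ x y → 4ℚ *ℚ x +ℚ y) (cEven-degree m k M<k) restrict ⟩
  4ℚ *ℚ 0ℚ +ℚ sumRange σ (k ∸ σ) h                     ≡⟨ trans (ℚP.+-identityˡ _) (sumRange-cong σ (k ∸ σ) by-IH) ⟩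
  sumRange σ (k ∸ σ) (λ s → Q s Y *ℚ Q (k ∸ s) Y)      ≡⟨ Q-products-sum k σ Y σ+σ≤k ⟩
  W σ k Y                                              ∎
  where
  open ≡-Reasoning
  m : ℕ
  m = suc m′
  k : ℕ
  k = suc k′
  M : ℕ
  M = 2 ^ m
  σ : ℕ
  σ = k ∸ M
  Y : ℚ
  Y = 4ℚ ^ℚ m
  h : ℕ → ℚ
  h s = cEven m s *ℚ cEven m (k ∸ s)
  1≤σ : 1 ≤ σ
  1≤σ = m<n⇒0<n∸m M<k
  k∸σ≡M : k ∸ σ ≡ M
  k∸σ≡M = m∸[m∸n]≡n (<⇒≤ M<k)
  σ+σ≤k : σ + σ ≤ k
  σ+σ≤k = subst (σ + σ ≤_) (m∸n+n≡m (<⇒≤ M<k))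
    (+-monoʳ-≤ σ (subst (σ ≤_) (m+n∸m≡n M M) (∸-monoˡ-≤ M (subst (k ≤_) (cong (_+_ M) (+-identityʳ M)) k≤2M))))
  restrict : sumRange 1 k′ h ≡ sumRange σ (k ∸ σ) h
  restrict = sumRange-restrict 1 k′ σ (k ∸ σ) h 1≤σ (≤-pred (subst (_< k) (sym k∸σ≡M) M<k)) outside
    where
    outside : ∀ s → 1 ≤ s → s ≤ k′ → s < σ ⊎ k ∸ σ < s → h s ≡ 0ℚ
    outside s _ _ (inj₁ s<σ)   = y≡0⇒x*y≡0 (cEven m s) (cEven-degree m (k ∸ s) (<∸-swap s<σ))
    outside s _ _ (inj₂ k∸σ<s) = x≡0⇒x*y≡0 (cEven m (k ∸ s)) (cEven-degree m s (subst (_< s) k∸σ≡M k∸σ<s))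
  by-IH : ∀ s → σ ≤ s → s ≤ k ∸ σ → h s ≡ Q s Y *ℚ Q (k ∸ s) Y
  by-IH s σ≤s s≤ = cong₂ _*ℚ_ (IH s (≤-trans 1≤σ σ≤s) s<k)
    (IH (k ∸ s) (m<n⇒0<n∸m s<k) (∸-monoʳ-< (≤-trans 1≤σ σ≤s) (<⇒≤ s<k)))
    where
    s<k : s < k
    s<k = ≤-<-trans (subst (s ≤_) k∸σ≡M s≤) M<k

-- With Z = 4^{η_k} = 4Y, the l-th term of a_{1,k} Z is w_σ(l,k) Y^l - a_{l,k} Z^l.
module FirstCoefficient (k′ : ℕ) (1≤k′ : 1 ≤ k′) where

  private
    k e : ℕ
    k = suc k′
    e = η k
    σ : ℕ
    σ = A.σₖ k
    Y Z : ℚ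
    Y = 4ℚ ^ℚ (e ∸ 1)
    Z = 4ℚ ^ℚ e
    1≤e : 1 ≤ e
    1≤e = ⌈log₂⌉-mono-≤ {2} {k} (s≤s 1≤k′)
    Z≡4Y : Z ≡ 4ℚ *ℚ Y
    Z≡4Y = cong (4ℚ ^ℚ_) (sym (m∸n+n≡m′ 1≤e))
      where
      m∸n+n≡m′ : ∀ {e} → 1 ≤ e → suc (e ∸ 1) ≡ e
      m∸n+n≡m′ (s≤s _) = refl

    term : ℕ → ℚ
    term l = (inv4^ l *ℚ A.w σ l k -ℚ A.aHigh l k) *ℚ ℕtoℚ (2 ^ (2 * η k * (l ∸ 1)))

    term*Z : ∀ l → 2 ≤ l → l ≤ k → term l *ℚ Z ^ℚ 1 ≡ A.w σ l k *ℚ Y ^ℚ l -ℚ a l k *ℚ Z ^ℚ l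
    term*Z l@(suc l″) 2≤l l≤k = begin
      (ι *ℚ w -ℚ A.aHigh l k) *ℚ ℕtoℚ (2 ^ (2 * e * l″)) *ℚ (Z *ℚ 1ℚ)
        ≡⟨ cong₂ (λ x y → (ι *ℚ w -ℚ x) *ℚ y *ℚ (Z *ℚ 1ℚ)) (sym (a-high l k 2≤l l≤k)) 2^≡Z^ ⟩
      (ι *ℚ w -ℚ a l k) *ℚ Z ^ℚ l″ *ℚ (Z *ℚ 1ℚ)
        ≡⟨ solve 3 (λ t p z → t :* p :* (z :* con 1ℚ) := t :* (z :* p)) refl (ι *ℚ w -ℚ a l k) (Z ^ℚ l″) Z ⟩
      (ι *ℚ w -ℚ a l k) *ℚ Z ^ℚ l
        ≡⟨ cong ((ι *ℚ w -ℚ a l k) *ℚ_) Z^≡ ⟩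
      (ι *ℚ w -ℚ a l k) *ℚ (4ˡ *ℚ Y ^ℚ l)
        ≡⟨ solve 5 (λ i w x q y → (i :* w :- x) :* (q :* y) := w :* y :* (i :* q) :- x :* (q :* y))
             refl ι w (a l k) 4ˡ (Y ^ℚ l) ⟩
      w *ℚ Y ^ℚ l *ℚ (ι *ℚ 4ˡ) -ℚ a l k *ℚ (4ˡ *ℚ Y ^ℚ l)
        ≡⟨ cong₂ (λ x y → w *ℚ Y ^ℚ l *ℚ x -ℚ a l k *ℚ y) (/-*-cancel (4 ^ l) {{m^n≢0 4 l}} (+ 1)) (sym Z^≡) ⟩
      w *ℚ Y ^ℚ l *ℚ 1ℚ -ℚ a l k *ℚ Z ^ℚ l
        ≡⟨ cong (_-ℚ a l k *ℚ Z ^ℚ l) (ℚP.*-identityʳ (w *ℚ Y ^ℚ l)) ⟩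
      w *ℚ Y ^ℚ l -ℚ a l k *ℚ Z ^ℚ l ∎
      where
      open ≡-Reasoning
      ι : ℚ
      ι = inv4^ l
      w : ℚ
      w = A.w σ l k
      4ˡ : ℚ
      4ˡ = ℕtoℚ (4 ^ l)
      2^≡Z^ : ℕtoℚ (2 ^ (2 * e * l″)) ≡ Z ^ℚ l″
      2^≡Z^ = trans (cong (λ x → ℕtoℚ (2 ^ x)) (*-assoc 2 e l″)) (trans (ℕtoℚ-2^[2*m] (e * l″)) (sym (^-assocʳ 4ℚ e l″)))
      Z^≡ : Z ^ℚ l ≡ 4ˡ *ℚ Y ^ℚ l
      Z^≡ = trans (cong (_^ℚ l) Z≡4Y) (trans (^-distrib-* 4ℚ Y l) (cong (_*ℚ Y ^ℚ l) (sym (ℕtoℚ-^ 4 l))))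

  Q-at-4^η : Q k Z ≡ W σ k Y
  Q-at-4^η = begin
    a 1 k *ℚ Z ^ℚ 1 +ℚ SA
      ≡⟨ cong (λ x → x *ℚ Z ^ℚ 1 +ℚ SA) (a-one k (s≤s 1≤k′)) ⟩
    sumFrom 2 k′ term *ℚ Z ^ℚ 1 +ℚ SA
      ≡⟨ cong (_+ℚ SA) (trans (sym (sumFrom-*ʳ 2 k′ (Z ^ℚ 1) term))
           (sumRange-cong 2 k (λ l 2≤l l≤k → term*Z l 2≤l l≤k))) ⟩
    sumFrom 2 k′ (λ l → A.w σ l k *ℚ Y ^ℚ l -ℚ a l k *ℚ Z ^ℚ l) +ℚ SA
      ≡⟨ sym (sumFrom-+ 2 k′ _ (λ l → a l k *ℚ Z ^ℚ l)) ⟩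
    sumFrom 2 k′ (λ l → A.w σ l k *ℚ Y ^ℚ l -ℚ a l k *ℚ Z ^ℚ l +ℚ a l k *ℚ Z ^ℚ l)
      ≡⟨ sumFrom-cong 2 k′ (λ l _ _ → solve 2 (λ x y → x :- y :+ y := x) refl (A.w σ l k *ℚ Y ^ℚ l) (a l k *ℚ Z ^ℚ l)) ⟩
    SW
      ≡⟨ sym (trans (cong (_+ℚ SW) (x≡0⇒x*y≡0 (Y ^ℚ 1) (w-at-1 σ k))) (ℚP.+-identityˡ SW)) ⟩
    A.w σ 1 k *ℚ Y ^ℚ 1 +ℚ SW ∎
    where
    open ≡-Reasoning
    SA : ℚ
    SA = sumFrom 2 k′ (λ l → a l k *ℚ Z ^ℚ l)
    SW : ℚ
    SW = sumFrom 2 k′ (λ l → A.w σ l k *ℚ Y ^ℚ l)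

formula-at-η : ∀ k → 3 ≤ k → FormulaBelow k → Formula (η k) k
formula-at-η k@(suc k′) 3≤k IH = begin
  cEven (η k) k            ≡⟨ cong (λ e → cEven e k) η≡1+m ⟩
  cEven (suc m) k          ≡⟨ cEven-first-level m k 1≤m (η-lower k (≤-trans (s≤s (s≤s z≤n)) 3≤k)) k≤2^[1+m]
                                (λ s 1≤s s<k → IH s 1≤s s<k m 1≤m) ⟩
  W (A.σₖ k) k (4ℚ ^ℚ m)   ≡⟨ sym (FirstCoefficient.Q-at-4^η k′ (≤-pred (≤-trans (s≤s (s≤s z≤n)) 3≤k))) ⟩
  Q k (4ℚ ^ℚ η k)          ∎
  where
  open ≡-Reasoning
  m : ℕ
  m = η k ∸ 1
  1≤m : 1 ≤ m
  1≤m = ∸-monoˡ-≤ 1 (⌈log₂⌉-mono-≤ {3} {k} 3≤k)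
  η≡1+m : η k ≡ suc m
  η≡1+m = sym (trans (+-comm 1 m) (m∸n+n≡m (≤-trans (s≤s z≤n) (⌈log₂⌉-mono-≤ {3} {k} 3≤k))))
  k≤2^[1+m] : k ≤ 2 ^ suc m
  k≤2^[1+m] = subst (λ e → k ≤ 2 ^ e) η≡1+m (η-upper k)

formula-from-below : ∀ k → 1 ≤ k → FormulaBelow k → ∀ n → 1 ≤ n → Formula n k
formula-from-below (suc zero)          _ IH = formula-propagates 0 IH 1 (s≤s z≤n) refl
formula-from-below (suc (suc zero))    _ IH = formula-propagates 1 IH 1 (s≤s z≤n) refl
formula-from-below k@(suc (suc (suc k″))) _ IH =
  formula-propagates (2 + k″) IH (η k) (⌈log₂⌉-mono-≤ {2} {k} (s≤s (s≤s z≤n)))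
    (formula-at-η k (s≤s (s≤s (s≤s z≤n))) IH)

formula : ∀ k → 1 ≤ k → ∀ n → 1 ≤ n → Formula n k
formula = <-rec (λ k → 1 ≤ k → ∀ n → 1 ≤ n → Formula n k)
  (λ k IH 1≤k → formula-from-below k 1≤k (λ s 1≤s s<k → IH s<k 1≤s))

Q-in-powers-of-2 : ∀ n k → sumRange 1 k (λ j → a j k ℚ.* ℕtoℚ (2 ^ (2 * j * n))) ≡ Q k (4ℚ ^ℚ n)
Q-in-powers-of-2 n k = sumRange-cong 1 k λ j _ _ → cong (a j k *ℚ_) (begin
  ℕtoℚ (2 ^ (2 * j * n))    ≡⟨ cong (λ x → ℕtoℚ (2 ^ x)) (trans (*-assoc 2 j n) (cong (2 *_) (*-comm j n))) ⟩
  ℕtoℚ (2 ^ (2 * (n * j)))  ≡⟨ ℕtoℚ-2^[2*m] (n * j) ⟩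
  4ℚ ^ℚ (n * j)             ≡⟨ sym (^-assocʳ 4ℚ n j) ⟩
  (4ℚ ^ℚ n) ^ℚ j            ∎)
  where open ≡-Reasoning

-- The formula holds for every k ≥ 1.
theorem2p5 : (n k : ℕ) → 1 ≤ n → k ≤ 2 ^ n →
    (c n 0 ≡ + 2) ×
    (1 ≤ k → ℤtoℚ (c n (2 * k)) ≡ sumRange 1 k (λ j → a j k ℚ.* ℕtoℚ (2 ^ (2 * j * n))))
theorem2p5 (suc n) k _ _ =
  c-zero n , λ 1≤k → trans (formula k 1≤k (suc n) (s≤s z≤n)) (sym (Q-in-powers-of-2 (suc n) k))
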